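{- For every integer $n\geq 4$, the dihedral group $D_{2n}$ of order $2n$ is not Cayley integral.
   Context: For a finite group $G$ with identity $1$ and a subset $S\subseteq G\setminus\{1\}$ with $S=S^{ -1}$, the undirected Cayley graph $Cay(G,S)$ has vertex set $G$, with vertices $a,b$ adjacent whenever $ab^{ -1}\in S$. A graph is integral if all eigenvalues of its adjacency matrix are integers. A finite group $G$ is called Cayley integral if $Cay(G,S)$ is integral for every such subset $S$. -}

module Defs where

open import Data.Nat as ℕ using (ℕ; zero; suc; NonZero)
open import Data.Nat.DivMod using (_mod_)
open import Data.Integer as ℤ using (ℤ; +_; _-_; _*_; -_)
open import Data.Fin as Fin using (Fin; zero; suc; toℕ; punchIn; remQuot; combine)
open import Data.Fin.Properties using (remQuot-combine; combine-remQuot)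
open import Data.Bool using (Bool; true; false; if_then_else_)
open import Data.Product using (_×_; _,_; ∃; uncurry)
open import Relation.Nullary using (isYes)
open import Relation.Binary.PropositionalEquality using (_≡_; _≢_; refl)

∑ : ∀ {n} → (Fin n → ℤ) → ℤ
∑ {zero}  f = + 0
∑ {suc n} f = f zero ℤ.+ ∑ (λ i → f (suc i))

∏ : ∀ {n} → (Fin n → ℤ) → ℤ
∏ {zero}  f = + 1
∏ {suc n} f = f zero * ∏ (λ i → f (suc i))

Matrix : ℕ → Set
Matrix n = Fin n → Fin n → ℤ

sign : ℕ → ℤ
sign zero = + 1
sign (suc k) = - sign k

det : ∀ {n} → Matrix n → ℤ
det {zero}  M = + 1
det {suc n} M = ∑ λ j → sign (toℕ j) * M zero j * det (λ r c → M (suc r) (punchIn j c))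

identity : ∀ {n} → Matrix n
identity i j = if isYes (i Fin.≟ j) then + 1 else + 0

charPolyAt : ∀ {n} → Matrix n → ℤ → ℤ
charPolyAt M t = det (λ i j → t * identity i j - M i j)

-- A (symmetric integer) matrix is integral if all its eigenvalues
-- (= roots of the characteristic polynomial, with multiplicity) are
-- integers, i.e. det (xI - M) = ∏ᵢ (x - λᵢ) for some integers λᵢ.
-- Equality of these integer polynomials is expressed as equality of
-- their values at every integer (equivalent for polynomials over ℤ).
IntegralMatrix : ∀ {n} → Matrix n → Set
IntegralMatrix {n} M =
  ∃ λ (eig : Fin n → ℤ) → ∀ (t : ℤ) → charPolyAt M t ≡ ∏ (λ i → t - eig i)

record FiniteGroup : Set₁ where
  field
    Carrier : Set
    _∙_     : Carrier → Carrier → Carrier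
    ε       : Carrier
    _⁻¹     : Carrier → Carrier
    order   : ℕ
    enum    : Fin order → Carrier
    index   : Carrier → Fin order
    enum-index : ∀ g → enum (index g) ≡ g
    index-enum : ∀ i → index (enum i) ≡ i

cayleyAdj : (G : FiniteGroup) → (FiniteGroup.Carrier G → Bool) →
            Matrix (FiniteGroup.order G)
cayleyAdj G S i j = if S (enum i ∙ (enum j ⁻¹)) then + 1 else + 0
  where open FiniteGroup G

CayleyIntegral : FiniteGroup → Set
CayleyIntegral G =
  ∀ (S : Carrier → Bool) →
    S ε ≡ false →
    (∀ g → S (g ⁻¹) ≡ S g) →
    IntegralMatrix (cayleyAdj G S)
  where open FiniteGroup G

-- The dihedral group D_{2n} = ⟨ r, s | rⁿ = s² = 1, s r s = r⁻¹ ⟩.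
-- The element (x , a) : Fin 2 × Fin n stands for rᵃ sˣ.
-- (x , a)(y , b) = (x + y mod 2 , a + (-1)ˣ b mod n).

module _ (n : ℕ) .{{_ : NonZero n}} where

  addR : Fin n → Fin n → Fin n
  addR a b = (toℕ a ℕ.+ toℕ b) mod n

  negR : Fin n → Fin n
  negR a = (n ℕ.∸ toℕ a) mod n

  addB : Fin 2 → Fin 2 → Fin 2
  addB x y = (toℕ x ℕ.+ toℕ y) mod 2

  dmul : Fin 2 × Fin n → Fin 2 × Fin n → Fin 2 × Fin n
  dmul (zero , a)  (y , b) = (y , addR a b)
  dmul (suc _ , a) (y , b) = (addB (suc zero) y , addR a (negR b))

  dinv : Fin 2 × Fin n → Fin 2 × Fin n
  dinv (zero , a)  = (zero , negR a)
  dinv (suc x , a) = (suc x , a)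

  Dihedral : FiniteGroup
  Dihedral = record
    { Carrier = Fin 2 × Fin n
    ; _∙_ = dmul
    ; ε = (zero , 0 mod n)
    ; _⁻¹ = dinv
    ; order = 2 ℕ.* n
    ; enum = remQuot n
    ; index = uncurry combine
    ; enum-index = λ { (x , a) → remQuot-combine x a }
    ; index-enum = combine-remQuot n
    }

module Submission where

open import Defs
open import Data.Nat using (ℕ; _≤_; NonZero)
open import Relation.Nullary using (¬_)

import Algebra.Properties.CommutativeSemigroup as CommutativeSemigroup
open import Data.Bool using (Bool; true; false; _∨_; if_then_else_)
open import Data.Bool.Properties using (¬-not; T-≡; ∨-comm)
open import Data.Empty using (⊥)
open import Data.Fin as Fin using (Fin; zero; suc; toℕ; punchIn; combine; remQuot)
open import Data.Fin.Properties using (toℕ-fromℕ<; toℕ<n; toℕ-injective; toℕ-combine; remQuot-combine; combine-remQuot)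
open import Data.Integer as ℤ using (ℤ; +_; -_; _+_; _*_; _-_; _^_; +0; -[1+_]; +[1+_]; ∣_∣)
import Data.Integer.Properties as ℤ
open import Data.Integer.Divisibility.Signed
  using (_∣_; _∣?_; divides; ∣-refl; ∣-trans; ∣m⇒∣m*n; ∣n⇒∣m*n; *-monoʳ-∣; *-cancelˡ-∣; ∣m+n∣n⇒∣m; ∣⇒∣ᵤ)
open import Data.Integer.Tactic.RingSolver using (solve-∀)
open import Data.List using (List; []; _∷_; map)
open import Data.List.Membership.Propositional using (_∈_)
open import Data.List.Membership.DecPropositional ℤ._≟_ using (_∈?_)
open import Data.List.Relation.Unary.All as All using (All; all?)
open import Data.List.Relation.Unary.Any using (here; there)
open import Data.Nat as ℕ using (zero; suc; z≤n; s≤s; _≡ᵇ_; _∸_; _%_; _/_)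
import Data.Nat.Divisibility as ℕ
open import Data.Nat.DivMod
  using (_mod_; m<n⇒m%n≡m; n%n≡0; m%n%n≡m%n; %-distribˡ-+; [m+n]%n≡m%n; m%n<n; m≡m%n+[m/n]*n)
open import Data.Nat.ListAction using (sum)
import Data.Nat.Properties as ℕ
open import Data.Product using (∃-syntax; _,_; _×_; proj₁; proj₂)
open import Data.Sum using (_⊎_; inj₁; inj₂; [_,_]′)
open import Function using (_∘_; id; flip)
open import Function.Bundles using (Equivalence)
open import Relation.Nullary using (yes; no; isYes; contradiction)
open import Relation.Nullary.Decidable using (toWitness; toWitnessFalse; _→-dec_)
open import Relation.Binary.PropositionalEquality

open CommutativeSemigroup ℤ.+-commutativeSemigroup using () renaming (interchange to ℤ-+-interchange)
open CommutativeSemigroup ℕ.+-commutativeSemigroup using () renaming (interchange to ℕ-+-interchange)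

∑< : ℕ → (ℕ → ℤ) → ℤ
∑< zero    f = + 0
∑< (suc m) f = f 0 + ∑< m (λ i → f (suc i))

∑<-cong : ∀ m {f g : ℕ → ℤ} → (∀ i → i ℕ.< m → f i ≡ g i) → ∑< m f ≡ ∑< m g
∑<-cong zero    f≗g = refl
∑<-cong (suc m) f≗g =
  cong₂ _+_ (f≗g 0 (s≤s z≤n)) (∑<-cong m (λ i i<m → f≗g (suc i) (s≤s i<m)))

∑<-zero : ∀ m {f : ℕ → ℤ} → (∀ i → i ℕ.< m → f i ≡ + 0) → ∑< m f ≡ + 0
∑<-zero zero    f≗0 = refl
∑<-zero (suc m) f≗0 =
  cong₂ _+_ (f≗0 0 (s≤s z≤n)) (∑<-zero m (λ i i<m → f≗0 (suc i) (s≤s i<m)))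

∑<-+ : ∀ m (f g : ℕ → ℤ) → ∑< m (λ i → f i + g i) ≡ ∑< m f + ∑< m g
∑<-+ zero    f g = refl
∑<-+ (suc m) f g = begin
  f 0 + g 0 + ∑< m (λ i → f (suc i) + g (suc i))
    ≡⟨ cong (_+_ (f 0 + g 0)) (∑<-+ m (λ i → f (suc i)) (λ i → g (suc i))) ⟩
  f 0 + g 0 + (∑< m (λ i → f (suc i)) + ∑< m (λ i → g (suc i)))
    ≡⟨ ℤ-+-interchange (f 0) (g 0) _ _ ⟩
  f 0 + ∑< m (λ i → f (suc i)) + (g 0 + ∑< m (λ i → g (suc i))) ∎
  where open ≡-Reasoning

∑<-*ˡ : ∀ m c (f : ℕ → ℤ) → c * ∑< m f ≡ ∑< m (λ i → c * f i)
∑<-*ˡ zero    c f = ℤ.*-zeroʳ c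
∑<-*ˡ (suc m) c f =
  trans (ℤ.*-distribˡ-+ c (f 0) _) (cong (_+_ (c * f 0)) (∑<-*ˡ m c (λ i → f (suc i))))

∑<-*ʳ : ∀ m c (f : ℕ → ℤ) → ∑< m f * c ≡ ∑< m (λ i → f i * c)
∑<-*ʳ m c f = trans (ℤ.*-comm (∑< m f) c)
  (trans (∑<-*ˡ m c f) (∑<-cong m (λ i _ → ℤ.*-comm c (f i))))

∑<-swap : ∀ m k (f : ℕ → ℕ → ℤ) →
  ∑< m (λ i → ∑< k (λ j → f i j)) ≡ ∑< k (λ j → ∑< m (λ i → f i j))
∑<-swap zero    k f = sym (∑<-zero k (λ _ _ → refl))
∑<-swap (suc m) k f =
  trans (cong (_+_ (∑< k (f 0))) (∑<-swap m k (λ i → f (suc i))))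
        (sym (∑<-+ k (f 0) (λ j → ∑< m (λ i → f (suc i) j))))

∑<-split : ∀ a b (f : ℕ → ℤ) → ∑< (a ℕ.+ b) f ≡ ∑< a f + ∑< b (λ i → f (a ℕ.+ i))
∑<-split zero    b f = sym (ℤ.+-identityˡ _)
∑<-split (suc a) b f =
  trans (cong (_+_ (f 0)) (∑<-split a b (λ i → f (suc i)))) (sym (ℤ.+-assoc (f 0) _ _))

∑<-ends : ∀ k (f : ℕ → ℤ) → (∀ i → i ℕ.< k → f (suc i) ≡ + 0) →
  ∑< (suc (suc k)) f ≡ f 0 + f (suc k)
∑<-ends k f inner≡0 = cong (_+_ (f 0)) (begin
  ∑< (suc k) (λ i → f (suc i))
    ≡⟨ cong (λ m → ∑< m (λ i → f (suc i))) (ℕ.+-comm 1 k) ⟩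
  ∑< (k ℕ.+ 1) (λ i → f (suc i))
    ≡⟨ ∑<-split k 1 (λ i → f (suc i)) ⟩
  ∑< k (λ i → f (suc i)) + (f (suc (k ℕ.+ 0)) + + 0)
    ≡⟨ cong₂ (λ x y → x + (f (suc y) + + 0)) (∑<-zero k inner≡0) (ℕ.+-identityʳ k) ⟩
  + 0 + (f (suc k) + + 0)
    ≡⟨ trans (ℤ.+-identityˡ _) (ℤ.+-identityʳ _) ⟩
  f (suc k) ∎)
  where open ≡-Reasoning

∑≡∑< : ∀ m (f : ℕ → ℤ) → ∑ {m} (λ j → f (toℕ j)) ≡ ∑< m f
∑≡∑< zero    f = refl
∑≡∑< (suc m) f = cong (_+_ (f 0)) (∑≡∑< m (λ i → f (suc i)))

∑-cong : ∀ {m} {f g : Fin m → ℤ} → (∀ i → f i ≡ g i) → ∑ f ≡ ∑ g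
∑-cong {zero}  f≗g = refl
∑-cong {suc m} f≗g = cong₂ _+_ (f≗g zero) (∑-cong (λ i → f≗g (suc i)))

*-zeroᵐ : ∀ a b c → b ≡ + 0 → a * b * c ≡ + 0
*-zeroᵐ a _ c refl = trans (cong (_* c) (ℤ.*-zeroʳ a)) (ℤ.*-zeroˡ c)

punchInℕ : ℕ → ℕ → ℕ
punchInℕ zero    c       = suc c
punchInℕ (suc j) zero    = zero
punchInℕ (suc j) (suc c) = suc (punchInℕ j c)

toℕ-punchIn : ∀ {m} (j : Fin (suc m)) (c : Fin m) → toℕ (punchIn j c) ≡ punchInℕ (toℕ j) (toℕ c)
toℕ-punchIn zero    c       = refl
toℕ-punchIn (suc j) zero    = refl
toℕ-punchIn (suc j) (suc c) = cong suc (toℕ-punchIn j c)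

punchInℕ-< : ∀ {j c} → c ℕ.< j → punchInℕ j c ≡ c
punchInℕ-< {suc j} {zero}  _         = refl
punchInℕ-< {suc j} {suc c} (s≤s c<j) = cong suc (punchInℕ-< c<j)

punchInℕ-≥ : ∀ {j c} → j ℕ.≤ c → punchInℕ j c ≡ suc c
punchInℕ-≥ {zero}  {c}     _         = refl
punchInℕ-≥ {suc j} {suc c} (s≤s j≤c) = cong suc (punchInℕ-≥ j≤c)

punchInℕ≤1+ : ∀ j c → punchInℕ j c ℕ.≤ suc c
punchInℕ≤1+ zero    c       = ℕ.≤-refl
punchInℕ≤1+ (suc j) zero    = z≤n
punchInℕ≤1+ (suc j) (suc c) = s≤s (punchInℕ≤1+ j c)

minor : ℕ → ℕ → (ℕ → ℕ → ℤ) → ℕ → ℕ → ℤ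
minor i j F r c = F (punchInℕ i r) (punchInℕ j c)

-- Laplace expansion along row 0, as for det; only the leading k × k block of F is read.
Det : ℕ → (ℕ → ℕ → ℤ) → ℤ
Det zero    F = + 1
Det (suc k) F = ∑< (suc k) (λ j → sign j * F 0 j * Det k (minor 0 j F))

det≡Det : ∀ k (M : Matrix k) (F : ℕ → ℕ → ℤ) →
  (∀ i j → M i j ≡ F (toℕ i) (toℕ j)) → det M ≡ Det k F
det≡Det zero    M F M≗F = refl
det≡Det (suc k) M F M≗F =
  trans (∑-cong (λ j → cong₂ (λ x y → sign (toℕ j) * x * y) (M≗F zero j)
                   (det≡Det k _ (minor 0 (toℕ j) F) (λ r c →
                     trans (M≗F (suc r) (punchIn j c)) (cong (F (suc (toℕ r))) (toℕ-punchIn j c))))))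
        (∑≡∑< (suc k) (λ j → sign j * F 0 j * Det k (minor 0 j F)))

Det-cong : ∀ k {F G : ℕ → ℕ → ℤ} →
  (∀ r c → r ℕ.< k → c ℕ.< k → F r c ≡ G r c) → Det k F ≡ Det k G
Det-cong zero    F≗G = refl
Det-cong (suc k) F≗G = ∑<-cong (suc k) (λ j j<1+k →
  cong₂ (λ x y → sign j * x * y) (F≗G 0 j (s≤s z≤n) j<1+k)
    (Det-cong k (λ r c r<k c<k →
      F≗G (suc r) (punchInℕ j c) (s≤s r<k) (ℕ.≤-<-trans (punchInℕ≤1+ j c) (s≤s c<k)))))

-- Expanding along row 0 and then each minor along its column 0.
private
  Det-bordered′ : ∀ k →
    (∀ G → Det (suc k) (flip G) ≡ Det (suc k) G) → (∀ G → Det k (flip G) ≡ Det k G) → ∀ F →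
    Det (suc (suc k)) F ≡
      F 0 0 * Det (suc k) (minor 0 0 F)
      + ∑< (suc k) (λ j → ∑< (suc k) (λ i →
          sign (suc j) * sign i * F 0 (suc j) * F (suc i) 0 * Det k (minor i j (minor 0 0 F))))
  Det-bordered′ k transpose₁₊ₖ transposeₖ F =
    cong₂ _+_ (cong (_* Det (suc k) (minor 0 0 F)) (ℤ.*-identityˡ (F 0 0)))
              (∑<-cong (suc k) (λ j _ → expand-minor j))
    where
    open ≡-Reasoning
    rearrange : ∀ a b c d e → a * b * (c * d * e) ≡ a * c * b * d * e
    rearrange = solve-∀
    expand-minor : ∀ j →
      sign (suc j) * F 0 (suc j) * Det (suc k) (minor 0 (suc j) F)
      ≡ ∑< (suc k) (λ i → sign (suc j) * sign i * F 0 (suc j) * F (suc i) 0 * Det k (minor i j (minor 0 0 F)))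
    expand-minor j = begin
      sign (suc j) * F 0 (suc j) * Det (suc k) (minor 0 (suc j) F)
        ≡⟨ cong (sign (suc j) * F 0 (suc j) *_) (sym (transpose₁₊ₖ (minor 0 (suc j) F))) ⟩
      sign (suc j) * F 0 (suc j) *
        ∑< (suc k) (λ i → sign i * F (suc i) 0 * Det k (flip (minor i j (minor 0 0 F))))
        ≡⟨ cong (sign (suc j) * F 0 (suc j) *_) (∑<-cong (suc k) (λ i _ →
             cong (sign i * F (suc i) 0 *_) (transposeₖ (minor i j (minor 0 0 F))))) ⟩
      sign (suc j) * F 0 (suc j) *
        ∑< (suc k) (λ i → sign i * F (suc i) 0 * Det k (minor i j (minor 0 0 F)))
        ≡⟨ ∑<-*ˡ (suc k) (sign (suc j) * F 0 (suc j))
             (λ i → sign i * F (suc i) 0 * Det k (minor i j (minor 0 0 F))) ⟩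
      ∑< (suc k) (λ i → sign (suc j) * F 0 (suc j) * (sign i * F (suc i) 0 * Det k (minor i j (minor 0 0 F))))
        ≡⟨ ∑<-cong (suc k) (λ i _ →
             rearrange (sign (suc j)) (F 0 (suc j)) (sign i) (F (suc i) 0) (Det k (minor i j (minor 0 0 F)))) ⟩
      ∑< (suc k) (λ i → sign (suc j) * sign i * F 0 (suc j) * F (suc i) 0 * Det k (minor i j (minor 0 0 F))) ∎

Det-transpose : ∀ k F → Det k (flip F) ≡ Det k F
Det-transpose zero          F = refl
Det-transpose (suc zero)    F = refl
Det-transpose (suc (suc k)) F = begin
  Det (suc (suc k)) (flip F)
    ≡⟨ Det-bordered′ k (Det-transpose (suc k)) (Det-transpose k) (flip F) ⟩
  F 0 0 * Det (suc k) (flip (minor 0 0 F))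
    + ∑< (suc k) (λ j → ∑< (suc k) (λ i →
        sign (suc j) * sign i * F (suc j) 0 * F 0 (suc i) * Det k (flip (minor j i (minor 0 0 F)))))
    ≡⟨ cong₂ _+_ (cong (F 0 0 *_) (Det-transpose (suc k) (minor 0 0 F)))
         (∑<-cong (suc k) (λ j _ → ∑<-cong (suc k) (λ i _ →
           trans (cong (sign (suc j) * sign i * F (suc j) 0 * F 0 (suc i) *_)
                       (Det-transpose k (minor j i (minor 0 0 F))))
                 (swap-roles (sign j) (sign i) _ _ _)))) ⟩
  F 0 0 * Det (suc k) (minor 0 0 F)
    + ∑< (suc k) (λ j → ∑< (suc k) (λ i →
        sign (suc i) * sign j * F 0 (suc i) * F (suc j) 0 * Det k (minor j i (minor 0 0 F))))
    ≡⟨ cong (_+_ (F 0 0 * Det (suc k) (minor 0 0 F))) (∑<-swap (suc k) (suc k) (λ j i →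
        sign (suc i) * sign j * F 0 (suc i) * F (suc j) 0 * Det k (minor j i (minor 0 0 F)))) ⟩
  F 0 0 * Det (suc k) (minor 0 0 F)
    + ∑< (suc k) (λ i → ∑< (suc k) (λ j →
        sign (suc i) * sign j * F 0 (suc i) * F (suc j) 0 * Det k (minor j i (minor 0 0 F))))
    ≡⟨ Det-bordered′ k (Det-transpose (suc k)) (Det-transpose k) F ⟨
  Det (suc (suc k)) F ∎
  where
  open ≡-Reasoning
  swap-roles : ∀ sj si a b x → (- sj) * si * a * b * x ≡ (- si) * sj * b * a * x
  swap-roles = solve-∀

Det-bordered : ∀ k F →
  Det (suc (suc k)) F ≡
    F 0 0 * Det (suc k) (minor 0 0 F)
    + ∑< (suc k) (λ j → ∑< (suc k) (λ i →
        sign (suc j) * sign i * F 0 (suc j) * F (suc i) 0 * Det k (minor i j (minor 0 0 F))))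
Det-bordered k = Det-bordered′ k (Det-transpose (suc k)) (Det-transpose k)

Det-zeroFirstRow : ∀ k F → (∀ j → j ℕ.< k → F 0 (suc j) ≡ + 0) →
  Det (suc k) F ≡ F 0 0 * Det k (minor 0 0 F)
Det-zeroFirstRow k F row≡0 = begin
  + 1 * F 0 0 * Det k (minor 0 0 F) + ∑< k (λ j → sign (suc j) * F 0 (suc j) * Det k (minor 0 (suc j) F))
    ≡⟨ cong₂ _+_ (cong (_* Det k (minor 0 0 F)) (ℤ.*-identityˡ (F 0 0)))
                 (∑<-zero k (λ j j<k → *-zeroᵐ (sign (suc j)) _ _ (row≡0 j j<k))) ⟩
  F 0 0 * Det k (minor 0 0 F) + + 0
    ≡⟨ ℤ.+-identityʳ _ ⟩
  F 0 0 * Det k (minor 0 0 F) ∎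
  where open ≡-Reasoning

Det-zeroFirstColumn : ∀ k F → (∀ i → i ℕ.< k → F (suc i) 0 ≡ + 0) →
  Det (suc k) F ≡ F 0 0 * Det k (minor 0 0 F)
Det-zeroFirstColumn k F col≡0 = begin
  Det (suc k) F                       ≡⟨ Det-transpose (suc k) F ⟨
  Det (suc k) (flip F)                ≡⟨ Det-zeroFirstRow k (flip F) col≡0 ⟩
  F 0 0 * Det k (flip (minor 0 0 F))  ≡⟨ cong (F 0 0 *_) (Det-transpose k (minor 0 0 F)) ⟩
  F 0 0 * Det k (minor 0 0 F)         ∎
  where open ≡-Reasoning

Det-lowerTriangular : ∀ k F → (∀ r c → r ℕ.< c → c ℕ.< k → F r c ≡ + 0) →
  Det k F ≡ ∏ {k} (λ i → F (toℕ i) (toℕ i))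
Det-lowerTriangular zero    F upper≡0 = refl
Det-lowerTriangular (suc k) F upper≡0 =
  trans (Det-zeroFirstRow k F (λ j j<k → upper≡0 0 (suc j) (s≤s z≤n) (s≤s j<k)))
        (cong (F 0 0 *_) (Det-lowerTriangular k (minor 0 0 F)
          (λ r c r<c c<k → upper≡0 (suc r) (suc c) (s≤s r<c) (s≤s c<k))))

Det-upperTriangular : ∀ k F → (∀ r c → c ℕ.< r → r ℕ.< k → F r c ≡ + 0) →
  Det k F ≡ ∏ {k} (λ i → F (toℕ i) (toℕ i))
Det-upperTriangular k F lower≡0 =
  trans (sym (Det-transpose k F)) (Det-lowerTriangular k (flip F) (λ r c r<c c<k → lower≡0 c r r<c c<k))

Det-blockTriangular : ∀ a b F → (∀ r c → r ℕ.< a → a ℕ.≤ c → F r c ≡ + 0) →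
  Det (a ℕ.+ b) F ≡ Det a F * Det b (λ r c → F (a ℕ.+ r) (a ℕ.+ c))
Det-blockTriangular zero    b F _          = sym (ℤ.*-identityˡ _)
Det-blockTriangular (suc a) b F corner≡0 = begin
  ∑< (suc a ℕ.+ b) term
    ≡⟨ ∑<-split (suc a) b term ⟩
  ∑< (suc a) term + ∑< b (λ i → term (suc a ℕ.+ i))
    ≡⟨ cong₂ _+_ (∑<-cong (suc a) left-term) (∑<-zero b right-term≡0) ⟩
  ∑< (suc a) (λ j → sign j * F 0 j * Det a (minor 0 j F) * D₂) + + 0
    ≡⟨ ℤ.+-identityʳ _ ⟩
  ∑< (suc a) (λ j → sign j * F 0 j * Det a (minor 0 j F) * D₂)
    ≡⟨ ∑<-*ʳ (suc a) D₂ (λ j → sign j * F 0 j * Det a (minor 0 j F)) ⟨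
  Det (suc a) F * D₂ ∎
  where
  open ≡-Reasoning
  D₂ : ℤ
  D₂ = Det b (λ r c → F (suc a ℕ.+ r) (suc a ℕ.+ c))
  term : ℕ → ℤ
  term j = sign j * F 0 j * Det (a ℕ.+ b) (minor 0 j F)
  right-term≡0 : ∀ i → i ℕ.< b → term (suc a ℕ.+ i) ≡ + 0
  right-term≡0 i _ = *-zeroᵐ (sign (suc a ℕ.+ i)) _ _ (corner≡0 0 (suc a ℕ.+ i) (s≤s z≤n) (ℕ.m≤m+n (suc a) i))
  left-term : ∀ j → j ℕ.< suc a → term j ≡ sign j * F 0 j * Det a (minor 0 j F) * D₂
  left-term j (s≤s j≤a) = begin
    sign j * F 0 j * Det (a ℕ.+ b) (minor 0 j F)
      ≡⟨ cong (sign j * F 0 j *_) (Det-blockTriangular a b (minor 0 j F) (λ r c r<a a≤c →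
           trans (cong (F (suc r)) (punchInℕ-≥ (ℕ.≤-trans j≤a a≤c))) (corner≡0 (suc r) (suc c) (s≤s r<a) (s≤s a≤c)))) ⟩
    sign j * F 0 j * (Det a (minor 0 j F) * Det b (λ r c → minor 0 j F (a ℕ.+ r) (a ℕ.+ c)))
      ≡⟨ cong (λ x → sign j * F 0 j * (Det a (minor 0 j F) * x)) (Det-cong b (λ r c _ _ →
           cong (F (suc a ℕ.+ r)) (punchInℕ-≥ (ℕ.≤-trans j≤a (ℕ.m≤m+n a c))))) ⟩
    sign j * F 0 j * (Det a (minor 0 j F) * D₂)
      ≡⟨ ℤ.*-assoc (sign j * F 0 j) _ _ ⟨
    sign j * F 0 j * Det a (minor 0 j F) * D₂ ∎

blockDiagonal : ℕ → (ℕ → ℕ → ℤ) → ℕ → ℕ → ℤ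
blockDiagonal n G r c =
  if r ℕ.<ᵇ n then (if c ℕ.<ᵇ n then G r c else + 0)
              else (if c ℕ.<ᵇ n then + 0 else G (r ℕ.∸ n) (c ℕ.∸ n))

<ᵇ-true : ∀ {m n} → m ℕ.< n → (m ℕ.<ᵇ n) ≡ true
<ᵇ-true m<n = Equivalence.to T-≡ (ℕ.<⇒<ᵇ m<n)

<ᵇ-false : ∀ {m n} → n ℕ.≤ m → (m ℕ.<ᵇ n) ≡ false
<ᵇ-false {m} {n} n≤m = ¬-not (λ m<ᵇn → ℕ.≤⇒≯ n≤m (ℕ.<ᵇ⇒< m n (Equivalence.from T-≡ m<ᵇn)))

Det-blockDiagonal : ∀ n G → Det (n ℕ.+ n) (blockDiagonal n G) ≡ Det n G * Det n G
Det-blockDiagonal n G = begin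
  Det (n ℕ.+ n) (blockDiagonal n G)
    ≡⟨ Det-blockTriangular n n (blockDiagonal n G) upper-right≡0 ⟩
  Det n (blockDiagonal n G) * Det n (λ r c → blockDiagonal n G (n ℕ.+ r) (n ℕ.+ c))
    ≡⟨ cong₂ _*_ (Det-cong n upper-left) (Det-cong n lower-right) ⟩
  Det n G * Det n G ∎
  where
  open ≡-Reasoning
  upper-right≡0 : ∀ r c → r ℕ.< n → n ℕ.≤ c → blockDiagonal n G r c ≡ + 0
  upper-right≡0 r c r<n n≤c rewrite <ᵇ-true r<n | <ᵇ-false n≤c = refl
  upper-left : ∀ r c → r ℕ.< n → c ℕ.< n → blockDiagonal n G r c ≡ G r c
  upper-left r c r<n c<n rewrite <ᵇ-true r<n | <ᵇ-true c<n = refl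
  lower-right : ∀ r c → r ℕ.< n → c ℕ.< n → blockDiagonal n G (n ℕ.+ r) (n ℕ.+ c) ≡ G r c
  lower-right r c _ _ rewrite <ᵇ-false (ℕ.m≤m+n n r) | <ᵇ-false (ℕ.m≤m+n n c)
    | ℕ.m+n∸m≡n n r | ℕ.m+n∸m≡n n c = refl

𝟙 : Bool → ℤ
𝟙 b = if b then + 1 else + 0

≡ᵇ-refl : ∀ n → (n ≡ᵇ n) ≡ true
≡ᵇ-refl zero    = refl
≡ᵇ-refl (suc n) = ≡ᵇ-refl n

≢⇒≡ᵇ-false : ∀ {m n} → m ≢ n → (m ≡ᵇ n) ≡ false
≢⇒≡ᵇ-false {m} {n} m≢n = ¬-not (λ eq → m≢n (ℕ.≡ᵇ⇒≡ m n (Equivalence.from T-≡ eq)))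

∏-cong : ∀ {k} {f g : Fin k → ℤ} → (∀ i → f i ≡ g i) → ∏ f ≡ ∏ g
∏-cong {zero}  f≗g = refl
∏-cong {suc k} f≗g = cong₂ _*_ (f≗g zero) (∏-cong (f≗g ∘ suc))

∏-minus-one : ∀ k → ∏ {k} (λ _ → - + 1) ≡ sign k
∏-minus-one zero    = refl
∏-minus-one (suc k) = trans (ℤ.-1*i≡-i _) (cong -_ (∏-minus-one k))

-- tI − A for the path 0 — 1 — 2 — ⋯
pathMatrix : ℤ → ℕ → ℕ → ℤ
pathMatrix t zero          zero          = t
pathMatrix t zero          (suc zero)    = - + 1
pathMatrix t zero          (suc (suc c)) = + 0
pathMatrix t (suc r)       (suc c)       = pathMatrix t r c
pathMatrix t (suc zero)    zero          = - + 1
pathMatrix t (suc (suc r)) zero          = + 0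

pathMatrix-sym : ∀ t r c → pathMatrix t r c ≡ pathMatrix t c r
pathMatrix-sym t zero          zero          = refl
pathMatrix-sym t zero          (suc zero)    = refl
pathMatrix-sym t zero          (suc (suc c)) = refl
pathMatrix-sym t (suc r)       (suc c)       = pathMatrix-sym t r c
pathMatrix-sym t (suc zero)    zero          = refl
pathMatrix-sym t (suc (suc r)) zero          = refl

pathMatrix-sub : ∀ t r → pathMatrix t (suc r) r ≡ - + 1
pathMatrix-sub t zero    = refl
pathMatrix-sub t (suc r) = pathMatrix-sub t r

pathMatrix-far : ∀ t r c → suc c ℕ.< r → pathMatrix t r c ≡ + 0
pathMatrix-far t (suc (suc r)) zero    _         = refl
pathMatrix-far t (suc r)       (suc c) (s≤s c<r) = pathMatrix-far t r c c<r

-- pathPoly t k = U_k(t/2), the characteristic polynomial of the path on k vertices.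
pathPoly : ℤ → ℕ → ℤ
pathPoly t zero          = + 1
pathPoly t (suc zero)    = t
pathPoly t (suc (suc k)) = t * pathPoly t (suc k) - pathPoly t k

Det-pathMatrix : ∀ t k → Det k (pathMatrix t) ≡ pathPoly t k
Det-pathMatrix t zero          = refl
Det-pathMatrix t (suc zero)    = trans (ℤ.+-identityʳ _) (trans (ℤ.*-identityʳ _) (ℤ.*-identityˡ t))
Det-pathMatrix t (suc (suc k)) = begin
  + 1 * t * Det (suc k) (pathMatrix t)
    + (- + 1 * - + 1 * Det (suc k) (minor 0 1 (pathMatrix t)) + ∑< k far-term)
    ≡⟨ cong₂ (λ x y → + 1 * t * Det (suc k) (pathMatrix t) + (- + 1 * - + 1 * x + y))
         (Det-zeroFirstColumn k (minor 0 1 (pathMatrix t)) (λ _ _ → refl))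
         (∑<-zero k (λ j _ → *-zeroᵐ (sign (suc (suc j))) _ _ refl)) ⟩
  + 1 * t * Det (suc k) (pathMatrix t) + (- + 1 * - + 1 * (- + 1 * Det k (pathMatrix t)) + + 0)
    ≡⟨ cong₂ (λ x y → + 1 * t * x + (- + 1 * - + 1 * (- + 1 * y) + + 0))
         (Det-pathMatrix t (suc k)) (Det-pathMatrix t k) ⟩
  + 1 * t * pathPoly t (suc k) + (- + 1 * - + 1 * (- + 1 * pathPoly t k) + + 0)
    ≡⟨ simplify t _ _ ⟩
  t * pathPoly t (suc k) - pathPoly t k ∎
  where
  open ≡-Reasoning
  far-term : ℕ → ℤ
  far-term j = sign (suc (suc j)) * + 0 * Det (suc k) (minor 0 (suc (suc j)) (pathMatrix t))
  simplify : ∀ t x y → + 1 * t * x + (- + 1 * - + 1 * (- + 1 * y) + + 0) ≡ t * x - y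
  simplify = solve-∀

sign-square : ∀ m → sign m * sign m ≡ + 1
sign-square zero    = refl
sign-square (suc m) = trans (neg-square (sign m)) (sign-square m)
  where
  neg-square : ∀ s → - s * - s ≡ s * s
  neg-square = solve-∀

pathEnd : ℕ → ℕ → Bool
pathEnd n c = (c ≡ᵇ 0) ∨ (c ≡ᵇ n ∸ 2)

-- tI − A for the n-cycle, seen as vertex 0 joined to both ends of the path 1 — 2 — ⋯ — (n − 1).
cycleMatrix : ℕ → ℤ → ℕ → ℕ → ℤ
cycleMatrix n t zero    zero    = t
cycleMatrix n t zero    (suc c) = - 𝟙 (pathEnd n c)
cycleMatrix n t (suc r) (suc c) = pathMatrix t r c
cycleMatrix n t (suc r) zero    = - 𝟙 (pathEnd n r)

module _ (k : ℕ) (t : ℤ) where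
  private
    n : ℕ
    n = suc (suc (suc k))
    C : ℕ → ℕ → ℤ
    C = cycleMatrix n t
    P : ℕ → ℕ → ℤ
    P = pathMatrix t
    D : ℤ
    D = pathPoly t (suc k)
    s : ℤ
    s = sign (suc k)

    pathEnd-last : pathEnd n (suc k) ≡ true
    pathEnd-last rewrite ≡ᵇ-refl k = refl

    pathEnd-inner : ∀ j → j ℕ.< k → pathEnd n (suc j) ≡ false
    pathEnd-inner j j<k rewrite ≢⇒≡ᵇ-false (ℕ.<⇒≢ j<k) = refl

    C-row-last : C 0 (suc (suc k)) ≡ - + 1
    C-row-last = cong (-_ ∘ 𝟙) pathEnd-last

    C-column-last : C (suc (suc k)) 0 ≡ - + 1
    C-column-last = cong (-_ ∘ 𝟙) pathEnd-last

    term : ℕ → ℕ → ℤ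
    term i j = sign (suc j) * sign i * C 0 (suc j) * C (suc i) 0 * Det (suc k) (minor i j P)

    Det-minor-corner : Det (suc k) (minor 0 (suc k) P) ≡ s
    Det-minor-corner = begin
      Det (suc k) (minor 0 (suc k) P)
        ≡⟨ Det-cong (suc k) (λ r c _ c<1+k → cong (P (suc r)) (punchInℕ-< c<1+k)) ⟩
      Det (suc k) (λ r c → P (suc r) c)
        ≡⟨ Det-upperTriangular (suc k) _ (λ r c c<r _ → pathMatrix-far t (suc r) c (s≤s c<r)) ⟩
      ∏ {suc k} (λ i → P (suc (toℕ i)) (toℕ i))
        ≡⟨ ∏-cong {suc k} (λ i → pathMatrix-sub t (toℕ i)) ⟩
      ∏ {suc k} (λ _ → - + 1)
        ≡⟨ ∏-minus-one (suc k) ⟩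
      s ∎
      where open ≡-Reasoning

    Det-minor-corner′ : Det (suc k) (minor (suc k) 0 P) ≡ s
    Det-minor-corner′ = begin
      Det (suc k) (minor (suc k) 0 P)
        ≡⟨ Det-cong (suc k) (λ r c _ _ → pathMatrix-sym t (punchInℕ (suc k) r) (suc c)) ⟩
      Det (suc k) (flip (minor 0 (suc k) P))
        ≡⟨ Det-transpose (suc k) (minor 0 (suc k) P) ⟩
      Det (suc k) (minor 0 (suc k) P)
        ≡⟨ Det-minor-corner ⟩
      s ∎
      where open ≡-Reasoning

    Det-minor-last : Det (suc k) (minor (suc k) (suc k) P) ≡ D
    Det-minor-last = trans
      (Det-cong (suc k) (λ r c r<1+k c<1+k → cong₂ P (punchInℕ-< r<1+k) (punchInℕ-< c<1+k)))
      (Det-pathMatrix t (suc k))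

    term-corner : ∀ i j → C 0 (suc j) ≡ - + 1 → C (suc i) 0 ≡ - + 1 →
      term i j ≡ sign (suc j) * sign i * Det (suc k) (minor i j P)
    term-corner i j row≡-1 column≡-1 = begin
      sign (suc j) * sign i * C 0 (suc j) * C (suc i) 0 * Det (suc k) (minor i j P)
        ≡⟨ cong₂ (λ x y → sign (suc j) * sign i * x * y * Det (suc k) (minor i j P)) row≡-1 column≡-1 ⟩
      sign (suc j) * sign i * - + 1 * - + 1 * Det (suc k) (minor i j P)
        ≡⟨ two-minus-ones (sign (suc j)) (sign i) _ ⟩
      sign (suc j) * sign i * Det (suc k) (minor i j P) ∎
      where
      open ≡-Reasoning
      two-minus-ones : ∀ a b x → a * b * - + 1 * - + 1 * x ≡ a * b * x
      two-minus-ones = solve-∀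

    inner-row≡0 : ∀ i j → j ℕ.< k → term i (suc j) ≡ + 0
    inner-row≡0 i j j<k = trans
      (cong (_* Det (suc k) (minor i (suc j) P))
        (*-zeroᵐ (sign (suc (suc j)) * sign i) (C 0 (suc (suc j))) (C (suc i) 0) (cong (-_ ∘ 𝟙) (pathEnd-inner j j<k))))
      (ℤ.*-zeroˡ (Det (suc k) (minor i (suc j) P)))

    inner-column≡0 : ∀ i j → i ℕ.< k → term (suc i) j ≡ + 0
    inner-column≡0 i j i<k =
      *-zeroᵐ (sign (suc j) * sign (suc i) * C 0 (suc j)) _ _ (cong (-_ ∘ 𝟙) (pathEnd-inner i i<k))

    column-sum : ∀ j → ∑< (suc (suc k)) (λ i → term i j) ≡ term 0 j + term (suc k) j
    column-sum j = ∑<-ends k (λ i → term i j) (λ i i<k → inner-column≡0 i j i<k)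

    corner-sum : ∑< (suc (suc k)) (λ j → ∑< (suc (suc k)) (λ i → term i j))
               ≡ (term 0 0 + term (suc k) 0) + (term 0 (suc k) + term (suc k) (suc k))
    corner-sum = trans
      (∑<-ends k (λ j → ∑< (suc (suc k)) (λ i → term i j))
        (λ j j<k → ∑<-zero (suc (suc k)) (λ i _ → inner-row≡0 i j j<k)))
      (cong₂ _+_ (column-sum 0) (column-sum (suc k)))

  Det-cycleMatrix : Det n C ≡ t * pathPoly t (suc (suc k)) - + 2 * D - + 2
  Det-cycleMatrix = begin
    Det n C
      ≡⟨ Det-bordered (suc k) C ⟩
    t * Det (suc (suc k)) P + ∑< (suc (suc k)) (λ j → ∑< (suc (suc k)) (λ i → term i j))
      ≡⟨ cong₂ (λ x y → t * x + y) (Det-pathMatrix t (suc (suc k))) corner-sum ⟩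
    t * pathPoly t (suc (suc k)) + ((term 0 0 + term (suc k) 0) + (term 0 (suc k) + term (suc k) (suc k)))
      ≡⟨ cong₂ (λ x y → t * pathPoly t (suc (suc k)) + (x + y))
           (cong₂ _+_ (trans (term-corner 0 0 refl refl) (cong (- + 1 * + 1 *_) (Det-pathMatrix t (suc k))))
                      (trans (term-corner (suc k) 0 refl C-column-last) (cong (- + 1 * s *_) Det-minor-corner′)))
           (cong₂ _+_ (trans (term-corner 0 (suc k) C-row-last refl) (cong (- s * + 1 *_) Det-minor-corner))
                      (trans (term-corner (suc k) (suc k) C-row-last C-column-last) (cong (- s * s *_) Det-minor-last))) ⟩
    t * pathPoly t (suc (suc k)) + ((- + 1 * + 1 * D + - + 1 * s * s) + (- s * + 1 * s + - s * s * D))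
      ≡⟨ collect (t * pathPoly t (suc (suc k))) D s ⟩
    t * pathPoly t (suc (suc k)) - (s * s) * D - D - (s * s) - (s * s)
      ≡⟨ cong (λ q → t * pathPoly t (suc (suc k)) - q * D - D - q - q) (sign-square (suc k)) ⟩
    t * pathPoly t (suc (suc k)) - + 1 * D - D - + 1 - + 1
      ≡⟨ tidy (t * pathPoly t (suc (suc k))) D ⟩
    t * pathPoly t (suc (suc k)) - + 2 * D - + 2 ∎
    where
    open ≡-Reasoning
    collect : ∀ x d s → x + ((- + 1 * + 1 * d + - + 1 * s * s) + (- s * + 1 * s + - s * s * d))
                      ≡ x - (s * s) * d - d - (s * s) - (s * s)
    collect = solve-∀
    tidy : ∀ x d → x - + 1 * d - d - + 1 - + 1 ≡ x - + 2 * d - + 2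
    tidy = solve-∀

ℕ-ind₂ : ∀ {ℓ} (P : ℕ → Set ℓ) → P 0 → P 1 → (∀ m → P m → P (suc m) → P (suc (suc m))) → ∀ m → P m
ℕ-ind₂ P p₀ p₁ step zero          = p₀
ℕ-ind₂ P p₀ p₁ step (suc zero)    = p₁
ℕ-ind₂ P p₀ p₁ step (suc (suc m)) = step m (ℕ-ind₂ P p₀ p₁ step m) (ℕ-ind₂ P p₀ p₁ step (suc m))

-- lucasV n (x + x⁻¹) = xⁿ + x⁻ⁿ, i.e. lucasV n t = 2 Tₙ(t/2).
lucasV : ℕ → ℤ → ℤ
lucasV zero          t = + 2
lucasV (suc zero)    t = t
lucasV (suc (suc m)) t = t * lucasV (suc m) t - lucasV m t

pathPoly-lucasV : ∀ m t → t * pathPoly t (suc m) - + 2 * pathPoly t m ≡ lucasV (suc (suc m)) t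
pathPoly-lucasV zero          t = cong (λ x → t * t - x) (ℤ.*-identityʳ (+ 2))
pathPoly-lucasV (suc zero)    t = cubic t
  where
  cubic : ∀ t → t * (t * t - + 1) - + 2 * t ≡ t * (t * t - + 2) - t
  cubic = solve-∀
pathPoly-lucasV (suc (suc m)) t = begin
  t * (t * pathPoly t (suc (suc m)) - pathPoly t (suc m)) - + 2 * pathPoly t (suc (suc m))
    ≡⟨ regroup t (pathPoly t (suc m)) (pathPoly t m) ⟩
  t * (t * pathPoly t (suc (suc m)) - + 2 * pathPoly t (suc m)) - (t * pathPoly t (suc m) - + 2 * pathPoly t m)
    ≡⟨ cong₂ (λ x y → t * x - y) (pathPoly-lucasV (suc m) t) (pathPoly-lucasV m t) ⟩
  t * lucasV (suc (suc (suc m))) t - lucasV (suc (suc m)) t ∎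
  where
  open ≡-Reasoning
  regroup : ∀ t a b → t * (t * (t * a - b) - a) - + 2 * (t * a - b)
                    ≡ t * (t * (t * a - b) - + 2 * a) - (t * a - + 2 * b)
  regroup = solve-∀

lucasV-neg : ∀ m t → lucasV m (- t) ≡ sign m * lucasV m t
lucasV-neg zero          t = refl
lucasV-neg (suc zero)    t = sym (ℤ.-1*i≡-i t)
lucasV-neg (suc (suc m)) t = begin
  - t * lucasV (suc m) (- t) - lucasV m (- t)
    ≡⟨ cong₂ (λ x y → - t * x - y) (lucasV-neg (suc m) t) (lucasV-neg m t) ⟩
  - t * (- sign m * lucasV (suc m) t) - sign m * lucasV m t
    ≡⟨ regroup (sign m) t _ _ ⟩
  - - sign m * (t * lucasV (suc m) t - lucasV m t) ∎
  where
  open ≡-Reasoning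
  regroup : ∀ s t a b → - t * (- s * a) - s * b ≡ - - s * (t * a - b)
  regroup = solve-∀

+-suc₂ : ∀ b y → b ℕ.+ suc (suc y) ≡ suc (suc (b ℕ.+ y))
+-suc₂ b y = trans (ℕ.+-suc b (suc y)) (cong suc (ℕ.+-suc b y))

lucasV-addition : ∀ b m t → lucasV (b ℕ.+ (b ℕ.+ m)) t + lucasV m t ≡ lucasV b t * lucasV (b ℕ.+ m) t
lucasV-addition zero          m t = double (lucasV m t)
  where
  double : ∀ x → x + x ≡ + 2 * x
  double = solve-∀
lucasV-addition (suc zero)    m t = cancel (t * lucasV (suc m) t) (lucasV m t)
  where
  cancel : ∀ x y → x - y + y ≡ x
  cancel = solve-∀
lucasV-addition (suc (suc b)) m t = begin
  V (suc (suc (b ℕ.+ suc (suc A)))) + V m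
    ≡⟨ cong (λ i → V (suc (suc i)) + V m) (+-suc₂ b A) ⟩
  t * V (3 ℕ.+ B) - V (2 ℕ.+ B) + V m
    ≡⟨ regroup t (V (3 ℕ.+ B)) (V (2 ℕ.+ B)) (V (suc m)) (V m) ⟩
  t * (V (3 ℕ.+ B) + V (suc m)) - (V (2 ℕ.+ B) + V (suc (suc m)))
    ≡⟨ cong₂ (λ x y → t * x - y)
         (step₁ (lucasV-addition (suc b) (suc m) t)) (step₀ (lucasV-addition b (suc (suc m)) t)) ⟩
  t * (V (suc b) * V (2 ℕ.+ A)) - V b * V (2 ℕ.+ A)
    ≡⟨ factor t (V (suc b)) (V b) (V (2 ℕ.+ A)) ⟩
  (t * V (suc b) - V b) * V (2 ℕ.+ A) ∎
  where
  open ≡-Reasoning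
  V : ℕ → ℤ
  V i = lucasV i t
  A B : ℕ
  A = b ℕ.+ m
  B = b ℕ.+ A
  regroup : ∀ t x y z w → t * x - y + w ≡ t * (x + z) - (y + (t * z - w))
  regroup = solve-∀
  factor : ∀ t x y z → t * (x * z) - y * z ≡ (t * x - y) * z
  factor = solve-∀
  step₀ : V (b ℕ.+ (b ℕ.+ suc (suc m))) + V (suc (suc m)) ≡ V b * V (b ℕ.+ suc (suc m)) →
          V (2 ℕ.+ B) + V (suc (suc m)) ≡ V b * V (2 ℕ.+ A)
  step₀ ih = begin
    V (2 ℕ.+ B) + V (suc (suc m))
      ≡⟨ cong (λ i → V i + V (suc (suc m))) (trans (cong (b ℕ.+_) (+-suc₂ b m)) (+-suc₂ b A)) ⟨
    V (b ℕ.+ (b ℕ.+ suc (suc m))) + V (suc (suc m))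
      ≡⟨ ih ⟩
    V b * V (b ℕ.+ suc (suc m))
      ≡⟨ cong (λ i → V b * V i) (+-suc₂ b m) ⟩
    V b * V (2 ℕ.+ A) ∎
  step₁ : V (suc b ℕ.+ (suc b ℕ.+ suc m)) + V (suc m) ≡ V (suc b) * V (suc b ℕ.+ suc m) →
          V (3 ℕ.+ B) + V (suc m) ≡ V (suc b) * V (2 ℕ.+ A)
  step₁ ih = begin
    V (3 ℕ.+ B) + V (suc m)
      ≡⟨ cong (λ i → V (suc i) + V (suc m)) (trans (cong (λ x → b ℕ.+ suc x) (ℕ.+-suc b m)) (+-suc₂ b A)) ⟨
    V (suc b ℕ.+ (suc b ℕ.+ suc m)) + V (suc m)
      ≡⟨ ih ⟩
    V (suc b) * V (suc b ℕ.+ suc m)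
      ≡⟨ cong (λ i → V (suc b) * V (suc i)) (ℕ.+-suc b m) ⟩
    V (suc b) * V (2 ℕ.+ A) ∎

lucasV-∘ : ∀ a b t → lucasV (a ℕ.* b) t ≡ lucasV a (lucasV b t)
lucasV-∘ zero          b t = refl
lucasV-∘ (suc zero)    b t = cong (λ i → lucasV i t) (ℕ.+-identityʳ b)
lucasV-∘ (suc (suc a)) b t = begin
  lucasV (b ℕ.+ (b ℕ.+ a ℕ.* b)) t
    ≡⟨ shift (lucasV (b ℕ.+ (b ℕ.+ a ℕ.* b)) t) (lucasV (a ℕ.* b) t) ⟩
  (lucasV (b ℕ.+ (b ℕ.+ a ℕ.* b)) t + lucasV (a ℕ.* b) t) - lucasV (a ℕ.* b) t
    ≡⟨ cong (_- lucasV (a ℕ.* b) t) (lucasV-addition b (a ℕ.* b) t) ⟩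
  lucasV b t * lucasV (suc a ℕ.* b) t - lucasV (a ℕ.* b) t
    ≡⟨ cong₂ (λ x y → lucasV b t * x - y) (lucasV-∘ (suc a) b t) (lucasV-∘ a b t) ⟩
  lucasV b t * lucasV (suc a) (lucasV b t) - lucasV a (lucasV b t) ∎
  where
  open ≡-Reasoning
  shift : ∀ x y → x ≡ (x + y) - y
  shift = solve-∀

module _ {b : ℕ} {r : ℤ} (at-period : lucasV b r ≡ + 2) (after-period : lucasV (suc b) r ≡ r) where

  lucasV-periodic : ∀ m → lucasV (m ℕ.+ b) r ≡ lucasV m r
  lucasV-periodic zero          = at-period
  lucasV-periodic (suc zero)    = after-period
  lucasV-periodic (suc (suc m)) =
    cong₂ (λ x y → r * x - y) (lucasV-periodic (suc m)) (lucasV-periodic m)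

  lucasV-mod : ∀ s q → lucasV (s ℕ.+ q ℕ.* b) r ≡ lucasV s r
  lucasV-mod s zero    = cong (λ i → lucasV i r) (ℕ.+-identityʳ s)
  lucasV-mod s (suc q) = begin
    lucasV (s ℕ.+ (b ℕ.+ q ℕ.* b)) r
      ≡⟨ cong (λ i → lucasV i r) (reorder s b (q ℕ.* b)) ⟩
    lucasV (s ℕ.+ q ℕ.* b ℕ.+ b) r
      ≡⟨ lucasV-periodic (s ℕ.+ q ℕ.* b) ⟩
    lucasV (s ℕ.+ q ℕ.* b) r
      ≡⟨ lucasV-mod s q ⟩
    lucasV s r ∎
    where
    open ≡-Reasoning
    reorder : ∀ x y z → x ℕ.+ (y ℕ.+ z) ≡ x ℕ.+ z ℕ.+ y
    reorder x y z = trans (cong (x ℕ.+_) (ℕ.+-comm y z)) (sym (ℕ.+-assoc x z y))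

lucasV-shift : ∀ m r z → ∃[ Z ] lucasV m (r + z) ≡ lucasV m r + z * Z
lucasV-shift m r z = ℕ-ind₂ P (+ 0 , base₀ r z) (+ 1 , base₁ r z) step m
  where
  P : ℕ → Set
  P m = ∃[ Z ] lucasV m (r + z) ≡ lucasV m r + z * Z
  base₀ : ∀ r z → + 2 ≡ + 2 + z * + 0
  base₀ = solve-∀
  base₁ : ∀ r z → r + z ≡ r + z * + 1
  base₁ = solve-∀
  expand : ∀ r z a b p q → (r + z) * (a + z * p) - (b + z * q) ≡ r * a - b + z * (a + (r + z) * p - q)
  expand = solve-∀
  step : ∀ m → P m → P (suc m) → P (suc (suc m))
  step m (Z₀ , e₀) (Z₁ , e₁) = lucasV (suc m) r + (r + z) * Z₁ - Z₀ , (begin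
    (r + z) * lucasV (suc m) (r + z) - lucasV m (r + z)
      ≡⟨ cong₂ (λ x y → (r + z) * x - y) e₁ e₀ ⟩
    (r + z) * (lucasV (suc m) r + z * Z₁) - (lucasV m r + z * Z₀)
      ≡⟨ expand r z (lucasV (suc m) r) (lucasV m r) Z₁ Z₀ ⟩
    r * lucasV (suc m) r - lucasV m r + z * (lucasV (suc m) r + (r + z) * Z₁ - Z₀) ∎)
    where open ≡-Reasoning

lucasV-near-2 : ∀ m u → ∃[ Y ] lucasV m (+ 2 + u) ≡ + 2 + u * (+ m * + m + u * Y)
lucasV-near-2 m u = ℕ-ind₂ P (+ 0 , base₀ u) (+ 0 , base₁ u) step m
  where
  P : ℕ → Set
  P m = ∃[ Y ] lucasV m (+ 2 + u) ≡ + 2 + u * (+ m * + m + u * Y)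
  base₀ : ∀ u → + 2 ≡ + 2 + u * (+ 0 * + 0 + u * + 0)
  base₀ = solve-∀
  base₁ : ∀ u → + 2 + u ≡ + 2 + u * (+ 1 * + 1 + u * + 0)
  base₁ = solve-∀
  expand : ∀ M u p q →
    (+ 2 + u) * (+ 2 + u * ((+ 1 + M) * (+ 1 + M) + u * p)) - (+ 2 + u * (M * M + u * q))
    ≡ + 2 + u * ((+ 2 + M) * (+ 2 + M) + u * ((+ 1 + M) * (+ 1 + M) + (+ 2 + u) * p - q))
  expand = solve-∀
  step : ∀ m → P m → P (suc m) → P (suc (suc m))
  step m (Y₀ , e₀) (Y₁ , e₁) = (+ 1 + + m) * (+ 1 + + m) + (+ 2 + u) * Y₁ - Y₀ , (begin
    (+ 2 + u) * lucasV (suc m) (+ 2 + u) - lucasV m (+ 2 + u)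
      ≡⟨ cong₂ (λ x y → (+ 2 + u) * x - y) e₁ e₀ ⟩
    (+ 2 + u) * (+ 2 + u * (+ suc m * + suc m + u * Y₁)) - (+ 2 + u * (+ m * + m + u * Y₀))
      ≡⟨ expand (+ m) u Y₁ Y₀ ⟩
    + 2 + u * (+ suc (suc m) * + suc (suc m) + u * ((+ 1 + + m) * (+ 1 + + m) + (+ 2 + u) * Y₁ - Y₀)) ∎)
    where open ≡-Reasoning

private
  lucasV-increasing : ∀ T m → ∃[ a ] ∃[ b ]
    lucasV m (+ (3 ℕ.+ T)) ≡ + 2 + + a × lucasV (suc m) (+ (3 ℕ.+ T)) ≡ + 3 + + a + + b
  lucasV-increasing T zero    = 0 , T , refl , refl
  lucasV-increasing T (suc m) with lucasV-increasing T m
  ... | a , b , eₘ , eₘ₊₁ = a ℕ.+ suc b , b ℕ.+ suc T ℕ.* (3 ℕ.+ a ℕ.+ b) , new-a , (begin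
    + (3 ℕ.+ T) * lucasV (suc m) t - lucasV m t
      ≡⟨ cong₂ (λ x y → + (3 ℕ.+ T) * x - y) eₘ₊₁ eₘ ⟩
    (+ 2 + + suc T) * (+ 3 + + a + + b) - (+ 2 + + a)
      ≡⟨ expand (+ suc T) (+ a) (+ b) ⟩
    + 3 + (+ a + (+ 1 + + b)) + (+ b + + suc T * (+ 3 + + a + + b))
      ≡⟨ cong₂ (λ x y → + 3 + x + y) (sym cast-a) (sym cast-b) ⟩
    + 3 + + (a ℕ.+ suc b) + + (b ℕ.+ suc T ℕ.* (3 ℕ.+ a ℕ.+ b)) ∎)
    where
    open ≡-Reasoning
    t : ℤ
    t = + (3 ℕ.+ T)
    expand : ∀ s a b → (+ 2 + s) * (+ 3 + a + b) - (+ 2 + a) ≡ + 3 + (a + (+ 1 + b)) + (b + s * (+ 3 + a + b))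
    expand = solve-∀
    cast-a : + (a ℕ.+ suc b) ≡ + a + (+ 1 + + b)
    cast-a = trans (ℤ.pos-+ a (suc b)) (cong (_+_ (+ a)) (ℤ.pos-+ 1 b))
    cast-b : + (b ℕ.+ suc T ℕ.* (3 ℕ.+ a ℕ.+ b)) ≡ + b + + suc T * (+ 3 + + a + + b)
    cast-b = trans (ℤ.pos-+ b _) (cong (_+_ (+ b)) (trans (ℤ.pos-* (suc T) _)
               (cong (+ suc T *_) (trans (ℤ.pos-+ (3 ℕ.+ a) b) (cong (λ x → x + + b) (ℤ.pos-+ 3 a))))))
    new-a : lucasV (suc m) t ≡ + 2 + + (a ℕ.+ suc b)
    new-a = trans eₘ₊₁ (trans (regroup (+ a) (+ b)) (cong (_+_ (+ 2)) (sym cast-a)))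
      where
      regroup : ∀ a b → + 3 + a + b ≡ + 2 + (a + (+ 1 + b))
      regroup = solve-∀

sign-cases : ∀ m → sign m ≡ + 1 ⊎ sign m ≡ - + 1
sign-cases zero    = inj₁ refl
sign-cases (suc m) with sign-cases m
... | inj₁ e = inj₂ (cong -_ e)
... | inj₂ e = inj₁ (cong -_ e)

lucasV-root-bound : ∀ m t → lucasV (suc m) t ≡ + 2 → ∣ t ∣ ℕ.≤ 2
lucasV-root-bound m (+ 0)             _ = z≤n
lucasV-root-bound m (+ 1)             _ = s≤s z≤n
lucasV-root-bound m (+ 2)             _ = ℕ.≤-refl
lucasV-root-bound m (+ suc (suc (suc T))) root with lucasV-increasing T m
... | a , b , _ , e = contradiction (trans (sym e) root) λ ()
lucasV-root-bound m -[1+ 0 ]          _ = s≤s z≤n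
lucasV-root-bound m -[1+ 1 ]          _ = ℕ.≤-refl
lucasV-root-bound m -[1+ suc (suc T) ] root with lucasV-increasing T m | sign-cases (suc m)
... | a , b , _ , e | inj₁ s≡1 =
  contradiction (trans (sym root) (trans (lucasV-neg (suc m) (+ (3 ℕ.+ T))) (cong₂ _*_ s≡1 e))) λ ()
... | a , b , _ , e | inj₂ s≡-1 =
  contradiction (trans (sym root) (trans (lucasV-neg (suc m) (+ (3 ℕ.+ T))) (cong₂ _*_ s≡-1 e))) λ ()

record Splits {N} (p : ℤ → ℤ) (λs : Fin N → ℤ) : Set where
  constructor splits
  field factorisation : ∀ t → p t ≡ ∏ (λ i → t - λs i)

multiplicity : ∀ {N} → (Fin N → ℤ) → ℤ → ℕ
multiplicity {zero}  λs r = 0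
multiplicity {suc N} λs r = (if isYes (λs zero ℤ.≟ r) then 1 else 0) ℕ.+ multiplicity (λs ∘ suc) r

∏-factor-∣ : ∀ {N} (f : Fin N → ℤ) i → f i ∣ ∏ f
∏-factor-∣ f zero    = ∣m⇒∣m*n _ ∣-refl
∏-factor-∣ f (suc i) = ∣n⇒∣m*n (f zero) (∏-factor-∣ (f ∘ suc) i)

∏-zero : ∀ {N} (f : Fin N → ℤ) i → f i ≡ + 0 → ∏ f ≡ + 0
∏-zero f zero    fi≡0 = trans (cong (_* ∏ (f ∘ suc)) fi≡0) (ℤ.*-zeroˡ (∏ (f ∘ suc)))
∏-zero f (suc i) fi≡0 = trans (cong (f zero *_) (∏-zero (f ∘ suc) i fi≡0)) (ℤ.*-zeroʳ (f zero))

multiplicity-∣ : ∀ {N} (λs : Fin N → ℤ) t r → (t - r) ^ multiplicity λs r ∣ ∏ (λ i → t - λs i)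
multiplicity-∣ {zero}  λs t r = ∣-refl
multiplicity-∣ {suc N} λs t r with λs zero ℤ.≟ r
... | yes refl = *-monoʳ-∣ (t - λs zero) (multiplicity-∣ (λs ∘ suc) t (λs zero))
... | no  _    = ∣n⇒∣m*n (t - λs zero) (multiplicity-∣ (λs ∘ suc) t r)

^-mono-∣ : ∀ m {a b} → a ℕ.≤ b → m ^ a ∣ m ^ b
^-mono-∣ m {zero}  {b}     _         = divides (m ^ b) (sym (ℤ.*-identityʳ _))
^-mono-∣ m {suc a} {suc b} (s≤s a≤b) = *-monoʳ-∣ m (^-mono-∣ m a≤b)

^-cancelˡ-∣ : ∀ m .{{_ : ℤ.NonZero m}} j {a b} → m ^ j * a ∣ m ^ j * b → a ∣ b
^-cancelˡ-∣ m zero    {a} {b} h = subst₂ _∣_ (ℤ.*-identityˡ a) (ℤ.*-identityˡ b) h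
^-cancelˡ-∣ m (suc j) {a} {b} h =
  ^-cancelˡ-∣ m j (*-cancelˡ-∣ m (subst₂ _∣_ (ℤ.*-assoc m (m ^ j) a) (ℤ.*-assoc m (m ^ j) b) h))

∣⇒∣∣≤∣∣ : ∀ {d v} → v ≢ + 0 → d ∣ v → ∣ d ∣ ℕ.≤ ∣ v ∣
∣⇒∣∣≤∣∣ {v = + 0}      v≢0 _   = contradiction refl v≢0
∣⇒∣∣≤∣∣ {v = +[1+ n ]} _   d∣v = ℕ.∣⇒≤ (∣⇒∣ᵤ d∣v)
∣⇒∣∣≤∣∣ {v = -[1+ n ]} _   d∣v = ℕ.∣⇒≤ (∣⇒∣ᵤ d∣v)

-- f (r + m) = mʲ (c + m Z) for all m: f vanishes to order j at r, with leading coefficient c.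
record TaylorAt (f : ℤ → ℤ) (r : ℤ) (j : ℕ) (c : ℤ) : Set where
  constructor taylorAt
  field expand : ∀ m → ∃[ Z ] f (r + m) ≡ m ^ j * (c + m * Z)
open TaylorAt public

TaylorAt-square : ∀ {f r j c} → TaylorAt f r j c → TaylorAt (λ t → f t * f t) r (j ℕ.+ j) (c * c)
TaylorAt-square {f} {r} {j} {c} (taylorAt expansion) = taylorAt square
  where
  open ≡-Reasoning
  regroup : ∀ p m c Z → p * (c + m * Z) * (p * (c + m * Z)) ≡ p * p * (c * c + m * (+ 2 * c * Z + m * Z * Z))
  regroup = solve-∀
  square : ∀ m → ∃[ Z ] f (r + m) * f (r + m) ≡ m ^ (j ℕ.+ j) * (c * c + m * Z)
  square m with expansion m
  ... | Z , e = + 2 * c * Z + m * Z * Z , (begin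
      f (r + m) * f (r + m)
        ≡⟨ cong₂ _*_ e e ⟩
      m ^ j * (c + m * Z) * (m ^ j * (c + m * Z))
        ≡⟨ regroup (m ^ j) m c Z ⟩
      m ^ j * m ^ j * (c * c + m * (+ 2 * c * Z + m * Z * Z))
        ≡⟨ cong (_* (c * c + m * (+ 2 * c * Z + m * Z * Z))) (ℤ.^-distribˡ-+-* m j j) ⟨
      m ^ (j ℕ.+ j) * (c * c + m * (+ 2 * c * Z + m * Z * Z)) ∎)

TaylorAt-∘ : ∀ {f g : ℤ → ℤ} {r s a c e} →
  TaylorAt (λ t → g t - s) s 1 a → TaylorAt (λ t → f t - s) r (suc e) c →
  TaylorAt (λ t → g (f t) - s) r (suc e) (a * c)
TaylorAt-∘ {f} {g} {r} {s} {a} {c} {e} (taylorAt outer) (taylorAt inner) = taylorAt composite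
  where
  open ≡-Reasoning
  recentre : ∀ x s → x ≡ s + (x - s)
  recentre = solve-∀
  regroup : ∀ m p a c Z Y → m * p * (c + m * Z) * + 1 * (a + m * p * (c + m * Z) * Y)
                          ≡ m * p * (a * c + m * (a * Z + p * (c + m * Z) * (c + m * Z) * Y))
  regroup = solve-∀
  composite : ∀ m → ∃[ W ] g (f (r + m)) - s ≡ m ^ suc e * (a * c + m * W)
  composite m with inner m
  ... | Z , eᵢ with outer (m ^ suc e * (c + m * Z))
  ... | Y , eₒ = a * Z + m ^ e * (c + m * Z) * (c + m * Z) * Y , (begin
      g (f (r + m)) - s
        ≡⟨ cong (λ x → g x - s) (trans (recentre (f (r + m)) s) (cong (_+_ s) eᵢ)) ⟩
      g (s + m ^ suc e * (c + m * Z)) - s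
        ≡⟨ eₒ ⟩
      m ^ suc e * (c + m * Z) * + 1 * (a + m ^ suc e * (c + m * Z) * Y)
        ≡⟨ regroup m (m ^ e) a c Z Y ⟩
      m ^ suc e * (a * c + m * (a * Z + m ^ e * (c + m * Z) * (c + m * Z) * Y)) ∎)

module _ {N} {p : ℤ → ℤ} {λs : Fin N → ℤ} (split : Splits p λs) where

  eigenvalue-∣ : ∀ t i → (t - λs i) ∣ p t
  eigenvalue-∣ t i = subst ((t - λs i) ∣_) (sym (Splits.factorisation split t)) (∏-factor-∣ (λ j → t - λs j) i)

  eigenvalue-root : ∀ i → p (λs i) ≡ + 0
  eigenvalue-root i = trans (Splits.factorisation split (λs i)) (∏-zero (λ j → λs i - λs j) i (ℤ.+-inverseʳ (λs i)))

  multiplicity≤ : ∀ t r b → ¬ ((t - r) ^ suc b ∣ p t) → multiplicity λs r ℕ.≤ b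
  multiplicity≤ t r b ¬∣ with multiplicity λs r ℕ.≤? b
  ... | yes mult≤b = mult≤b
  ... | no  mult≰b = contradiction
    (∣-trans (^-mono-∣ (t - r) (ℕ.≰⇒> mult≰b))
             (subst ((t - r) ^ multiplicity λs r ∣_) (sym (Splits.factorisation split t)) (multiplicity-∣ λs t r)))
    ¬∣

  -- Evaluate at r + m with m = 1 + ∣c∣: then m ∤ c, so (r + m) − r = m divides p (r + m) at most j times.
  multiplicity≤order : ∀ {r j c} → TaylorAt p r j c → c ≢ + 0 → multiplicity λs r ℕ.≤ j
  multiplicity≤order {r} {j} {c} (taylorAt expansion) c≢0 = multiplicity≤ (r + m) r j ¬∣
    where
    m : ℤ
    m = + suc ∣ c ∣
    Z : ℤ
    Z = proj₁ (expansion m)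
    ¬∣ : ¬ ((r + m - r) ^ suc j ∣ p (r + m))
    ¬∣ mʲ⁺¹∣ = ℕ.<-irrefl refl (∣⇒∣∣≤∣∣ c≢0 m∣c)
      where
      m∣c+mZ : m ∣ c + m * Z
      m∣c+mZ = ^-cancelˡ-∣ m j (subst₂ _∣_
        (trans (cong (_^ suc j) (cancel r m)) (ℤ.*-comm m (m ^ j))) (proj₂ (expansion m)) mʲ⁺¹∣)
        where
        cancel : ∀ r m → r + m - r ≡ m
        cancel = solve-∀
      m∣c : m ∣ c
      m∣c = ∣m+n∣n⇒∣m m∣c+mZ (∣m⇒∣m*n Z ∣-refl)

sum-map-+ : ∀ {A : Set} (f g : A → ℕ) xs → sum (map (λ x → f x ℕ.+ g x) xs) ≡ sum (map f xs) ℕ.+ sum (map g xs)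
sum-map-+ f g []       = refl
sum-map-+ f g (x ∷ xs) = trans (cong (f x ℕ.+ g x ℕ.+_) (sum-map-+ f g xs)) (ℕ-+-interchange (f x) (g x) _ _)

pigeonhole : ∀ {N} (λs : Fin N → ℤ) R → (∀ i → λs i ∈ R) → N ℕ.≤ sum (map (multiplicity λs) R)
pigeonhole {zero}  λs R _       = z≤n
pigeonhole {suc N} λs R λs∈R =
  subst (suc N ℕ.≤_) (sym (sum-map-+ hit (multiplicity (λs ∘ suc)) R))
    (ℕ.+-mono-≤ (hit≥1 R (λs∈R zero)) (pigeonhole (λs ∘ suc) R (λs∈R ∘ suc)))
  where
  hit : ℤ → ℕ
  hit r = if isYes (λs zero ℤ.≟ r) then 1 else 0
  hit≥1 : ∀ R → λs zero ∈ R → 1 ℕ.≤ sum (map hit R)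
  hit≥1 (r ∷ R) (here refl) with λs zero ℤ.≟ λs zero
  ... | yes _  = s≤s z≤n
  ... | no  ≢r = contradiction refl ≢r
  hit≥1 (r ∷ R) (there x∈R) = ℕ.≤-trans (hit≥1 R x∈R) (ℕ.m≤n+m _ (hit r))

window : ℕ → List ℤ
window zero    = + 0 ∷ []
window (suc B) = + suc B ∷ -[1+ B ] ∷ window B

∈-window : ∀ {x} B → ∣ x ∣ ℕ.≤ B → x ∈ window B
∈-window {+ 0}      zero    _    = here refl
∈-window {+ suc n}  (suc B) n<1+B with ℕ.m≤n⇒m<n∨m≡n n<1+B
... | inj₁ (s≤s n<B) = there (there (∈-window B n<B))
... | inj₂ refl      = here refl
∈-window { -[1+ n ]} (suc B) n<1+B with ℕ.m≤n⇒m<n∨m≡n n<1+B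
... | inj₁ (s≤s n<B) = there (there (∈-window B n<B))
... | inj₂ refl      = there (here refl)
∈-window {+ 0}      (suc B) _    = there (there (∈-window B z≤n))


module _ {N} {p : ℤ → ℤ} {λs : Fin N → ℤ} (split : Splits p λs) where

  eigenvalue-search : ∀ c {v} → p c ≡ v → v ≢ + 0 → (Q : ℤ → Set) →
    All (λ d → d ∣ v → Q (c - d)) (window ∣ v ∣) → ∀ i → Q (λs i)
  eigenvalue-search c {v} p≡v v≢0 Q candidates i = subst Q (recentre c (λs i))
    (All.lookup candidates (∈-window ∣ v ∣ (∣⇒∣∣≤∣∣ v≢0 c-λ∣v)) c-λ∣v)
    where
    c-λ∣v : (c - λs i) ∣ v
    c-λ∣v = subst ((c - λs i) ∣_) p≡v (eigenvalue-∣ split c i)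
    recentre : ∀ c x → c - (c - x) ≡ x
    recentre = solve-∀

  multiplicity≤-at : ∀ t r b {v} → p t ≡ v → ¬ ((t - r) ^ suc b ∣ v) → multiplicity λs r ℕ.≤ b
  multiplicity≤-at t r b p≡v ¬∣ = multiplicity≤ split t r b (¬∣ ∘ subst ((t - r) ^ suc b ∣_) p≡v)

module _ (k : ℕ) where
  private
    n : ℕ
    n = suc (suc (suc k))

  isNeighbour : ℕ → Bool
  isNeighbour a = (a ≡ᵇ 1) ∨ (a ≡ᵇ n ∸ 1)

  rotation±1 : Fin 2 × Fin n → Bool
  rotation±1 (zero  , a) = isNeighbour (toℕ a)
  rotation±1 (suc _ , _) = false

  diffMod : ℕ → ℕ → ℕ
  diffMod a b = (a ℕ.+ (n ∸ b) % n) % n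

  toℕ-addR-negR : ∀ a b → toℕ (addR n a (negR n b)) ≡ diffMod (toℕ a) (toℕ b)
  toℕ-addR-negR a b = trans (toℕ-fromℕ< _) (cong (λ x → (toℕ a ℕ.+ x) % n) (toℕ-fromℕ< _))

  private
    ∸≡ᵇ1 : ∀ m y → y ℕ.≤ suc m → ((suc m ∸ y) ≡ᵇ 1) ≡ (y ≡ᵇ m)
    ∸≡ᵇ1 zero    zero          _         = refl
    ∸≡ᵇ1 zero    (suc zero)    _         = refl
    ∸≡ᵇ1 zero    (suc (suc y)) (s≤s ())
    ∸≡ᵇ1 (suc m) zero          _         = refl
    ∸≡ᵇ1 (suc m) (suc y)       (s≤s y≤m) = ∸≡ᵇ1 m y y≤m

    ∸≡ᵇself : ∀ m y → y ℕ.≤ m → ((m ∸ y) ≡ᵇ m) ≡ (y ≡ᵇ 0)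
    ∸≡ᵇself m       zero    _         = ≡ᵇ-refl m
    ∸≡ᵇself (suc m) (suc y) (s≤s y≤m) = ≢⇒≡ᵇ-false (ℕ.<⇒≢ (s≤s (ℕ.m∸n≤m m y)))

    diffMod-normal : ∀ a b → b ℕ.≤ n → diffMod a b ≡ (a ℕ.+ (n ∸ b)) % n
    diffMod-normal a b _ = begin
      (a ℕ.+ (n ∸ b) % n) % n            ≡⟨ %-distribˡ-+ a ((n ∸ b) % n) n ⟩
      (a % n ℕ.+ (n ∸ b) % n % n) % n    ≡⟨ cong (λ x → (a % n ℕ.+ x) % n) (m%n%n≡m%n (n ∸ b) n) ⟩
      (a % n ℕ.+ (n ∸ b) % n) % n        ≡⟨ %-distribˡ-+ a (n ∸ b) n ⟨
      (a ℕ.+ (n ∸ b)) % n ∎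
      where open ≡-Reasoning

  isNeighbour-neg : ∀ x → x ℕ.< n → isNeighbour ((n ∸ x) % n) ≡ isNeighbour x
  isNeighbour-neg zero    _ = cong isNeighbour (n%n≡0 n)
  isNeighbour-neg (suc y) (s≤s y<2+k) = begin
    isNeighbour ((suc (suc k) ∸ y) % n)
      ≡⟨ cong isNeighbour (m<n⇒m%n≡m (s≤s (ℕ.m∸n≤m (suc (suc k)) y))) ⟩
    ((suc (suc k) ∸ y) ≡ᵇ 1) ∨ ((suc (suc k) ∸ y) ≡ᵇ suc (suc k))
      ≡⟨ cong₂ _∨_ (∸≡ᵇ1 (suc k) y (ℕ.<⇒≤ y<2+k)) (∸≡ᵇself (suc (suc k)) y (ℕ.<⇒≤ y<2+k)) ⟩
    (y ≡ᵇ suc k) ∨ (y ≡ᵇ 0)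
      ≡⟨ ∨-comm (y ≡ᵇ suc k) (y ≡ᵇ 0) ⟩
    isNeighbour (suc y) ∎
    where open ≡-Reasoning

  diffMod-zeroʳ : ∀ a → a ℕ.< n → diffMod a 0 ≡ a
  diffMod-zeroʳ a a<n = trans (diffMod-normal a 0 z≤n)
    (trans ([m+n]%n≡m%n a n) (m<n⇒m%n≡m a<n))

  isNeighbour-diffMod-zeroˡ : ∀ b → b ℕ.< n → isNeighbour (diffMod 0 b) ≡ isNeighbour b
  isNeighbour-diffMod-zeroˡ b b<n = trans (cong isNeighbour (m%n%n≡m%n (n ∸ b) n)) (isNeighbour-neg b b<n)

  diffMod-suc : ∀ a b → suc b ℕ.< n → diffMod (suc a) (suc b) ≡ diffMod a b
  diffMod-suc a b 1+b<n = begin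
    diffMod (suc a) (suc b)         ≡⟨ diffMod-normal (suc a) (suc b) (ℕ.<⇒≤ 1+b<n) ⟩
    (suc a ℕ.+ (n ∸ suc b)) % n     ≡⟨ cong (_% n) shift ⟩
    (a ℕ.+ (n ∸ b)) % n             ≡⟨ diffMod-normal a b (ℕ.<⇒≤ (ℕ.<-trans (ℕ.n<1+n b) 1+b<n)) ⟨
    diffMod a b                     ∎
    where
    open ≡-Reasoning
    shift : suc a ℕ.+ (n ∸ suc b) ≡ a ℕ.+ (n ∸ b)
    shift = trans (sym (ℕ.+-suc a (n ∸ suc b))) (cong (a ℕ.+_) (sym (ℕ.+-∸-assoc 1 (ℕ.<⇒≤ 1+b<n))))

  private
    diagonal : ∀ t → t * + 1 - + 0 ≡ t
    diagonal = solve-∀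
    off-diagonal : ∀ t x → t * + 0 - x ≡ - x
    off-diagonal = solve-∀

    isNeighbour-far : ∀ c → c ℕ.< k → isNeighbour (suc (suc c)) ≡ false
    isNeighbour-far c c<k = ≢⇒≡ᵇ-false (ℕ.<⇒≢ c<k)

  pathBlock-entry : ∀ t r c → r ℕ.< suc (suc k) → c ℕ.< suc (suc k) →
    t * 𝟙 (r ≡ᵇ c) - 𝟙 (isNeighbour (diffMod r c)) ≡ pathMatrix t r c
  pathBlock-entry t zero zero _ _ =
    trans (cong (λ x → t * + 1 - 𝟙 (isNeighbour x)) (diffMod-zeroʳ 0 (s≤s z≤n))) (diagonal t)
  pathBlock-entry t zero (suc c) _ c<2+k =
    trans (cong (λ b → t * + 0 - 𝟙 b) (isNeighbour-diffMod-zeroˡ (suc c) (ℕ.<-trans c<2+k (ℕ.n<1+n _))))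
          (trans (off-diagonal t _) (edge c c<2+k))
    where
    edge : ∀ c → suc c ℕ.< suc (suc k) → - 𝟙 (isNeighbour (suc c)) ≡ pathMatrix t zero (suc c)
    edge zero    _               = refl
    edge (suc c) (s≤s (s≤s c<k)) = cong (-_ ∘ 𝟙) (isNeighbour-far c c<k)
  pathBlock-entry t (suc r) zero r<2+k _ =
    trans (cong (λ x → t * + 0 - 𝟙 (isNeighbour x)) (diffMod-zeroʳ (suc r) (ℕ.<-trans r<2+k (ℕ.n<1+n _))))
          (trans (off-diagonal t _) (edge r r<2+k))
    where
    edge : ∀ r → suc r ℕ.< suc (suc k) → - 𝟙 (isNeighbour (suc r)) ≡ pathMatrix t (suc r) zero
    edge zero    _               = refl
    edge (suc r) (s≤s (s≤s r<k)) = cong (-_ ∘ 𝟙) (isNeighbour-far r r<k)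
  pathBlock-entry t (suc r) (suc c) (s≤s r<1+k) (s≤s c<1+k) =
    trans (cong (λ x → t * 𝟙 (r ≡ᵇ c) - 𝟙 (isNeighbour x)) (diffMod-suc r c (s≤s (ℕ.<-trans c<1+k (ℕ.n<1+n _)))))
          (pathBlock-entry t r c (ℕ.<-trans r<1+k (ℕ.n<1+n _)) (ℕ.<-trans c<1+k (ℕ.n<1+n _)))

  cycleBlock-entry : ∀ t a b → a ℕ.< n → b ℕ.< n →
    t * 𝟙 (a ≡ᵇ b) - 𝟙 (isNeighbour (diffMod a b)) ≡ cycleMatrix n t a b
  cycleBlock-entry t zero zero _ _ = pathBlock-entry t 0 0 (s≤s z≤n) (s≤s z≤n)
  cycleBlock-entry t zero (suc c) _ c<n =
    trans (cong (λ b → t * + 0 - 𝟙 b) (isNeighbour-diffMod-zeroˡ (suc c) c<n)) (off-diagonal t _)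
  cycleBlock-entry t (suc r) zero r<n _ =
    trans (cong (λ x → t * + 0 - 𝟙 (isNeighbour x)) (diffMod-zeroʳ (suc r) r<n)) (off-diagonal t _)
  cycleBlock-entry t (suc r) (suc c) (s≤s r<n-1) (s≤s c<n-1) =
    trans (cong (λ x → t * 𝟙 (r ≡ᵇ c) - 𝟙 (isNeighbour x)) (diffMod-suc r c (s≤s c<n-1)))
          (pathBlock-entry t r c r<n-1 c<n-1)

identity≡𝟙 : ∀ {m} (i j : Fin m) → identity i j ≡ 𝟙 (toℕ i ≡ᵇ toℕ j)
identity≡𝟙 i j with i Fin.≟ j
... | yes refl = cong 𝟙 (sym (≡ᵇ-refl (toℕ i)))
... | no  i≢j  = cong 𝟙 (sym (≢⇒≡ᵇ-false (i≢j ∘ toℕ-injective)))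

+-≡ᵇ : ∀ m a b → (m ℕ.+ a ≡ᵇ m ℕ.+ b) ≡ (a ≡ᵇ b)
+-≡ᵇ zero    a b = refl
+-≡ᵇ (suc m) a b = +-≡ᵇ m a b

module _ (k : ℕ) where
  private
    n : ℕ
    n = suc (suc (suc k))

    blockStart : Fin 2 → ℕ
    blockStart zero    = 0
    blockStart (suc _) = n

    toℕ-combine′ : ∀ x (a : Fin n) → toℕ (combine {2} x a) ≡ blockStart x ℕ.+ toℕ a
    toℕ-combine′ zero       a = trans (toℕ-combine {2} zero a) (cong (ℕ._+ toℕ a) (ℕ.*-zeroʳ n))
    toℕ-combine′ (suc zero) a = trans (toℕ-combine {2} (suc zero) a) (cong (ℕ._+ toℕ a) (ℕ.*-identityʳ n))

    zero-entry : ∀ t → t * + 0 - + 0 ≡ + 0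
    zero-entry = solve-∀

  rotationCharMatrix-entry : ∀ t i j →
    t * identity i j - cayleyAdj (Dihedral n) (rotation±1 k) i j ≡
    blockDiagonal n (cycleMatrix n t) (toℕ i) (toℕ j)
  rotationCharMatrix-entry t i j = subst₂ (λ i j → t * identity i j - cayleyAdj (Dihedral n) (rotation±1 k) i j ≡
                                                   blockDiagonal n (cycleMatrix n t) (toℕ i) (toℕ j))
    (combine-remQuot {2} n i) (combine-remQuot {2} n j)
    (on-blocks (proj₁ (remQuot {2} n i)) (proj₂ (remQuot {2} n i)) (proj₁ (remQuot {2} n j)) (proj₂ (remQuot {2} n j)))
    where
    block-entry : ∀ (x : Fin 2) (a : Fin n) (y : Fin 2) (b : Fin n) A B →
      A ≡ blockStart x ℕ.+ toℕ a → B ≡ blockStart y ℕ.+ toℕ b →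
      t * 𝟙 (A ≡ᵇ B) - 𝟙 (rotation±1 k (dmul n (x , a) (dinv n (y , b)))) ≡ blockDiagonal n (cycleMatrix n t) A B
    block-entry zero a zero b _ _ refl refl
      rewrite toℕ-addR-negR k a b | <ᵇ-true (toℕ<n a) | <ᵇ-true (toℕ<n b)
      = cycleBlock-entry k t (toℕ a) (toℕ b) (toℕ<n a) (toℕ<n b)
    block-entry zero a (suc zero) b _ _ refl refl
      rewrite <ᵇ-true (toℕ<n a) | <ᵇ-false (ℕ.m≤m+n n (toℕ b))
            | ≢⇒≡ᵇ-false (ℕ.<⇒≢ (ℕ.<-≤-trans (toℕ<n a) (ℕ.m≤m+n n (toℕ b))))
      = zero-entry t
    block-entry (suc zero) a zero b _ _ refl refl
      rewrite <ᵇ-false (ℕ.m≤m+n n (toℕ a)) | <ᵇ-true (toℕ<n b)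
            | ≢⇒≡ᵇ-false (ℕ.<⇒≢ (ℕ.<-≤-trans (toℕ<n b) (ℕ.m≤m+n n (toℕ a))) ∘ sym)
      = zero-entry t
    block-entry (suc zero) a (suc zero) b _ _ refl refl
      rewrite +-≡ᵇ n (toℕ a) (toℕ b) | toℕ-addR-negR k a b
            | <ᵇ-false (ℕ.m≤m+n n (toℕ a)) | <ᵇ-false (ℕ.m≤m+n n (toℕ b))
            | ℕ.m+n∸m≡n n (toℕ a) | ℕ.m+n∸m≡n n (toℕ b)
      = cycleBlock-entry k t (toℕ a) (toℕ b) (toℕ<n a) (toℕ<n b)

    on-blocks : ∀ (x : Fin 2) (a : Fin n) (y : Fin 2) (b : Fin n) →
      t * identity (combine x a) (combine y b) - cayleyAdj (Dihedral n) (rotation±1 k) (combine x a) (combine y b)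
      ≡ blockDiagonal n (cycleMatrix n t) (toℕ (combine x a)) (toℕ (combine y b))
    on-blocks x a y b = trans
      (cong₂ (λ e c → t * e - c) (identity≡𝟙 (combine x a) (combine y b)) cayley-entry)
      (block-entry x a y b _ _ (toℕ-combine′ x a) (toℕ-combine′ y b))
      where
      cayley-entry : cayleyAdj (Dihedral n) (rotation±1 k) (combine x a) (combine y b)
                   ≡ 𝟙 (rotation±1 k (dmul n (x , a) (dinv n (y , b))))
      cayley-entry rewrite remQuot-combine {2} {n} x a | remQuot-combine {2} {n} y b = refl

  rotation±1-inverse : ∀ g → rotation±1 k (dinv n g) ≡ rotation±1 k g
  rotation±1-inverse (zero  , a) =
    trans (cong (isNeighbour k) (toℕ-fromℕ< (m%n<n (n ∸ toℕ a) n))) (isNeighbour-neg k (toℕ a) (toℕ<n a))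
  rotation±1-inverse (suc _ , _) = refl

  charPolyAt-rotation±1 : ∀ t →
    charPolyAt (cayleyAdj (Dihedral n) (rotation±1 k)) t ≡ (lucasV n t - + 2) * (lucasV n t - + 2)
  charPolyAt-rotation±1 t = begin
    charPolyAt (cayleyAdj (Dihedral n) (rotation±1 k)) t
      ≡⟨ det≡Det (2 ℕ.* n) _ (blockDiagonal n C) (rotationCharMatrix-entry t) ⟩
    Det (n ℕ.+ (n ℕ.+ 0)) (blockDiagonal n C)
      ≡⟨ cong (λ m → Det (n ℕ.+ m) (blockDiagonal n C)) (ℕ.+-identityʳ n) ⟩
    Det (n ℕ.+ n) (blockDiagonal n C)
      ≡⟨ Det-blockDiagonal n C ⟩
    Det n C * Det n C
      ≡⟨ cong (λ d → d * d) (trans (Det-cycleMatrix k t) (cong (_- + 2) (pathPoly-lucasV (suc k) t))) ⟩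
    (lucasV n t - + 2) * (lucasV n t - + 2) ∎
    where
    open ≡-Reasoning
    C : ℕ → ℕ → ℤ
    C = cycleMatrix n t

cycleCharPoly : ℕ → ℤ → ℤ
cycleCharPoly n t = lucasV n t - + 2

TaylorAt-cong : ∀ {f g r j c} → (∀ t → f t ≡ g t) → TaylorAt f r j c → TaylorAt g r j c
TaylorAt-cong {r = r} f≗g (taylorAt expansion) = taylorAt λ m →
  proj₁ (expansion m) , trans (sym (f≗g (r + m))) (proj₂ (expansion m))

cycleCharPoly-near-2 : ∀ q → TaylorAt (cycleCharPoly q) (+ 2) 1 (+ q * + q)
cycleCharPoly-near-2 q = taylorAt near-2
  where
  regroup : ∀ a u Y → + 2 + u * (a + u * Y) - + 2 ≡ u * + 1 * (a + u * Y)
  regroup = solve-∀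
  near-2 : ∀ u → ∃[ Y ] cycleCharPoly q (+ 2 + u) ≡ u ^ 1 * (+ q * + q + u * Y)
  near-2 u with lucasV-near-2 q u
  ... | Y , e = Y , trans (cong (_- + 2) e) (regroup (+ q * + q) u Y)

cycleCharPoly-shift : ∀ n r → TaylorAt (cycleCharPoly n) r 0 (cycleCharPoly n r)
cycleCharPoly-shift n r = taylorAt shift
  where
  regroup : ∀ v m Z → v + m * Z - + 2 ≡ + 1 * ((v - + 2) + m * Z)
  regroup = solve-∀
  shift : ∀ m → ∃[ Z ] cycleCharPoly n (r + m) ≡ m ^ 0 * (cycleCharPoly n r + m * Z)
  shift m with lucasV-shift n r m
  ... | Z , e = Z , trans (cong (_- + 2) e) (regroup (lucasV n r) m Z)

-- r = 2 cos (2π / period), a root of cycleCharPoly n exactly when period ∣ n.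
record LucasRoot (r : ℤ) : Set where
  field
    period       : ℕ
    {{period≢0}} : ℕ.NonZero period
    order-1      : ℕ
    leading      : ℤ
    leading≢0    : leading ≢ + 0
    expansion    : TaylorAt (cycleCharPoly period) r (suc order-1) leading
    after-period : lucasV (suc period) r ≡ r
    off-period   : ∀ s → 0 ℕ.< s → s ℕ.< period → lucasV s r ≢ + 2

*-≢0 : ∀ {x y} → x ≢ + 0 → y ≢ + 0 → x * y ≢ + 0
*-≢0 {x} x≢0 y≢0 xy≡0 = [ x≢0 , y≢0 ]′ (ℤ.i*j≡0⇒i≡0∨j≡0 x xy≡0)

module _ {r} (R : LucasRoot r) where
  open LucasRoot R

  multiplicityBound : ℕ → ℕ
  multiplicityBound n = if isYes (period ℕ.∣? n) then suc order-1 ℕ.+ suc order-1 else 0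

  private
    at-period : lucasV period r ≡ + 2
    at-period with expand expansion (+ 0)
    ... | _ , e = ℤ.i-j≡0⇒i≡j _ _ (trans (cong (λ x → lucasV period x - + 2) (sym (ℤ.+-identityʳ r))) e)

    cycleCharPoly-at-root : ∀ q → TaylorAt (cycleCharPoly (q ℕ.* period)) r (suc order-1) (+ q * + q * leading)
    cycleCharPoly-at-root q = TaylorAt-cong (λ t → cong (_- + 2) (sym (lucasV-∘ q period t)))
      (TaylorAt-∘ {f = lucasV period} {g = lucasV q} (cycleCharPoly-near-2 q) expansion)

    cycleCharPoly-off-root : ∀ n → ¬ (period ℕ.∣ n) → cycleCharPoly n r ≢ + 0
    cycleCharPoly-off-root n period∤n Q≡0 = off-period (n % period) 0<s (m%n<n n period) (begin
      lucasV (n % period) r                              ≡⟨ lucasV-mod at-period after-period (n % period) (n / period) ⟨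
      lucasV (n % period ℕ.+ (n / period) ℕ.* period) r  ≡⟨ cong (λ i → lucasV i r) (m≡m%n+[m/n]*n n period) ⟨
      lucasV n r                                         ≡⟨ ℤ.i-j≡0⇒i≡j _ _ Q≡0 ⟩
      + 2 ∎)
      where
      open ≡-Reasoning
      0<s : 0 ℕ.< n % period
      0<s with n % period in s≡
      ... | suc _ = s≤s z≤n
      ... | zero  = contradiction (ℕ.divides (n / period) (trans (m≡m%n+[m/n]*n n period) (cong (ℕ._+ (n / period) ℕ.* period) s≡))) period∤n

  multiplicity≤multiplicityBound : ∀ {N} {λs : Fin N → ℤ} n → 0 ℕ.< n →
    Splits (λ t → cycleCharPoly n t * cycleCharPoly n t) λs → multiplicity λs r ℕ.≤ multiplicityBound n
  multiplicity≤multiplicityBound n 0<n split with period ℕ.∣? n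
  ... | yes (ℕ.divides q n≡q*period) = multiplicity≤order split
          (TaylorAt-square
            (subst (λ m → TaylorAt (cycleCharPoly m) r (suc order-1) (+ q * + q * leading)) (sym n≡q*period)
              (cycleCharPoly-at-root q)))
          (*-≢0 lead≢0 lead≢0)
    where
    q≢0 : + q ≢ + 0
    q≢0 q≡0 = ℕ.<⇒≢ 0<n (sym (trans n≡q*period (cong (ℕ._* period) (ℤ.+-injective q≡0))))
    lead≢0 : + q * + q * leading ≢ + 0
    lead≢0 = *-≢0 (*-≢0 q≢0 q≢0) leading≢0
  ... | no  period∤n = multiplicity≤order split
          (TaylorAt-square (cycleCharPoly-shift n r))
          (*-≢0 (cycleCharPoly-off-root n period∤n) (cycleCharPoly-off-root n period∤n))

lucasRoot-2 : LucasRoot (+ 2)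
lucasRoot-2 = record
  { period = 1 ; order-1 = 0 ; leading = + 1 ; leading≢0 = λ ()
  ; expansion = taylorAt (λ m → + 0 , expansion-identity m)
  ; after-period = refl
  ; off-period = λ { (suc _) _ (s≤s ()) }
  }
  where
  expansion-identity : ∀ m → + 2 + m - + 2 ≡ m * + 1 * (+ 1 + m * + 0)
  expansion-identity = solve-∀

lucasRoot-−2 : LucasRoot (- + 2)
lucasRoot-−2 = record
  { period = 2 ; order-1 = 0 ; leading = - + 4 ; leading≢0 = λ ()
  ; expansion = taylorAt (λ m → + 1 , expansion-identity m)
  ; after-period = refl
  ; off-period = λ { 1 _ _ → λ () ; (suc (suc _)) _ (s≤s (s≤s ())) }
  }
  where
  expansion-identity : ∀ m → let x = - + 2 + m in x * x - + 2 - + 2 ≡ m * + 1 * (- + 4 + m * + 1)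
  expansion-identity = solve-∀

lucasRoot-0 : LucasRoot (+ 0)
lucasRoot-0 = record
  { period = 4 ; order-1 = 1 ; leading = - + 4 ; leading≢0 = λ ()
  ; expansion = taylorAt (λ m → m , expansion-identity m)
  ; after-period = refl
  ; off-period = λ { 1 _ _ → λ () ; 2 _ _ → λ () ; 3 _ _ → λ ()
                   ; (suc (suc (suc (suc _)))) _ (s≤s (s≤s (s≤s (s≤s ())))) }
  }
  where
  expansion-identity : ∀ m → let x = + 0 + m in x * (x * (x * x - + 2) - x) - (x * x - + 2) - + 2
                                      ≡ m * (m * + 1) * (- + 4 + m * m)
  expansion-identity = solve-∀

lucasRoot-1 : LucasRoot (+ 1)
lucasRoot-1 = record
  { period = 6 ; order-1 = 1 ; leading = - + 12 ; leading≢0 = λ ()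
  ; expansion = taylorAt (λ m → - + 4 + + 9 * m + + 6 * m * m + m * m * m , expansion-identity m)
  ; after-period = refl
  ; off-period = λ { 1 _ _ → λ () ; 2 _ _ → λ () ; 3 _ _ → λ () ; 4 _ _ → λ () ; 5 _ _ → λ ()
                   ; (suc (suc (suc (suc (suc (suc _)))))) _ (s≤s (s≤s (s≤s (s≤s (s≤s (s≤s ())))))) }
  }
  where
  expansion-identity : ∀ m → let x = + 1 + m ; v₂ = x * x - + 2 ; v₃ = x * v₂ - x ; v₄ = x * v₃ - v₂ ; v₅ = x * v₄ - v₃
                   in x * v₅ - v₄ - + 2 ≡ m * (m * + 1) * (- + 12 + m * (- + 4 + + 9 * m + + 6 * m * m + m * m * m))
  expansion-identity = solve-∀

lucasRoot-−1 : LucasRoot (- + 1)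
lucasRoot-−1 = record
  { period = 3 ; order-1 = 1 ; leading = - + 3 ; leading≢0 = λ ()
  ; expansion = taylorAt (λ m → + 1 , expansion-identity m)
  ; after-period = refl
  ; off-period = λ { 1 _ _ → λ () ; 2 _ _ → λ () ; (suc (suc (suc _))) _ (s≤s (s≤s (s≤s ()))) }
  }
  where
  expansion-identity : ∀ m → let x = - + 1 + m in x * (x * x - + 2) - x - + 2 ≡ m * (m * + 1) * (- + 3 + m * + 1)
  expansion-identity = solve-∀

multiplicityBoundTotal : ℕ → ℕ
multiplicityBoundTotal n =
  multiplicityBound lucasRoot-2 n ℕ.+ (multiplicityBound lucasRoot-−2 n ℕ.+ (multiplicityBound lucasRoot-1 n
    ℕ.+ (multiplicityBound lucasRoot-−1 n ℕ.+ (multiplicityBound lucasRoot-0 n ℕ.+ 0))))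

multiplicityBound≤ : ∀ {r} (R : LucasRoot r) n → multiplicityBound R n ℕ.≤ suc (LucasRoot.order-1 R) ℕ.+ suc (LucasRoot.order-1 R)
multiplicityBound≤ R n with LucasRoot.period R ℕ.∣? n
... | yes _ = ℕ.≤-refl
... | no  _ = z≤n

multiplicityBoundTotal<2n : ∀ n → 5 ℕ.≤ n → n ≢ 6 → multiplicityBoundTotal n ℕ.< 2 ℕ.* n
multiplicityBoundTotal<2n 0 () _
multiplicityBoundTotal<2n 1 (s≤s ()) _
multiplicityBoundTotal<2n 2 (s≤s (s≤s ())) _
multiplicityBoundTotal<2n 3 (s≤s (s≤s (s≤s ()))) _
multiplicityBoundTotal<2n 4 (s≤s (s≤s (s≤s (s≤s ())))) _
multiplicityBoundTotal<2n 5 _ _ = toWitness {a? = multiplicityBoundTotal 5 ℕ.<? 10} _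
multiplicityBoundTotal<2n 6 _ n≢6 = contradiction refl n≢6
multiplicityBoundTotal<2n 7 _ _ = toWitness {a? = multiplicityBoundTotal 7 ℕ.<? 14} _
multiplicityBoundTotal<2n 8 _ _ = toWitness {a? = multiplicityBoundTotal 8 ℕ.<? 16} _
multiplicityBoundTotal<2n n@(suc (suc (suc (suc (suc (suc (suc (suc (suc m))))))))) _ _ = ℕ.≤-trans (s≤s total≤16) doubled≥17
  where
  total≤16 : multiplicityBoundTotal n ℕ.≤ 16
  total≤16 = ℕ.+-mono-≤ (multiplicityBound≤ lucasRoot-2 n) (ℕ.+-mono-≤ (multiplicityBound≤ lucasRoot-−2 n)
    (ℕ.+-mono-≤ (multiplicityBound≤ lucasRoot-1 n) (ℕ.+-mono-≤ (multiplicityBound≤ lucasRoot-−1 n)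
      (ℕ.+-mono-≤ (multiplicityBound≤ lucasRoot-0 n) z≤n))))
  doubled≥17 : 17 ℕ.≤ 2 ℕ.* n
  doubled≥17 = ℕ.≤-trans (ℕ.n≤1+n 17) (ℕ.*-monoʳ-≤ 2 (ℕ.m≤m+n 9 m))

square≡0 : ∀ x → x * x ≡ + 0 → x ≡ + 0
square≡0 x x²≡0 = [ id , id ]′ (ℤ.i*j≡0⇒i≡0∨j≡0 x x²≡0)

rotation±1-not-integral : ∀ k → 2 ℕ.≤ k → k ≢ 3 → ¬ CayleyIntegral (Dihedral (3 ℕ.+ k))
rotation±1-not-integral k 2≤k k≢3 cayleyIntegral =
  ℕ.<-irrefl refl (ℕ.<-≤-trans (multiplicityBoundTotal<2n n (s≤s (s≤s (s≤s 2≤k))) (k≢3 ∘ ℕ.+-cancelˡ-≡ 3 k 3))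
                               (ℕ.≤-trans (pigeonhole λs (window 2) in-window) counted))
  where
  n : ℕ
  n = 3 ℕ.+ k
  λs : Fin (2 ℕ.* n) → ℤ
  λs = proj₁ (cayleyIntegral (rotation±1 k) refl (rotation±1-inverse k))
  split : Splits (λ t → cycleCharPoly n t * cycleCharPoly n t) λs
  split = splits λ t →
    trans (sym (charPolyAt-rotation±1 k t)) (proj₂ (cayleyIntegral (rotation±1 k) refl (rotation±1-inverse k)) t)
  in-window : ∀ i → λs i ∈ window 2
  in-window i = ∈-window 2 (lucasV-root-bound (suc (suc k)) (λs i)
    (ℤ.i-j≡0⇒i≡j _ _ (square≡0 _ (eigenvalue-root split i))))
  counted : sum (map (multiplicity λs) (window 2)) ℕ.≤ multiplicityBoundTotal n
  counted = ℕ.+-mono-≤ (multiplicity≤multiplicityBound lucasRoot-2 n (s≤s z≤n) split)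
           (ℕ.+-mono-≤ (multiplicity≤multiplicityBound lucasRoot-−2 n (s≤s z≤n) split)
           (ℕ.+-mono-≤ (multiplicity≤multiplicityBound lucasRoot-1 n (s≤s z≤n) split)
           (ℕ.+-mono-≤ (multiplicity≤multiplicityBound lucasRoot-−1 n (s≤s z≤n) split)
           (ℕ.+-mono-≤ (multiplicity≤multiplicityBound lucasRoot-0 n (s≤s z≤n) split) z≤n))))

-- Guarding each Laplace term by its entry skips the minors of zero entries,
-- which is what makes closed determinants of sparse matrices feasible to normalise.
unlessZero : ℤ → ℤ → ℤ
unlessZero +0       _ = +0
unlessZero +[1+ _ ] x = x
unlessZero -[1+ _ ] x = x

sparseDet : ∀ {n} → Matrix n → ℤ
sparseDet {zero}  M = + 1
sparseDet {suc n} M =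
  ∑ λ j → unlessZero (M zero j) (sign (toℕ j) * M zero j * sparseDet (λ r c → M (suc r) (punchIn j c)))

sparseDet≡det : ∀ {n} (M : Matrix n) → sparseDet M ≡ det M
sparseDet≡det {zero}  M = refl
sparseDet≡det {suc n} M = ∑-cong λ j →
  trans (cong (λ d → unlessZero (M zero j) (sign (toℕ j) * M zero j * d)) (sparseDet≡det (minor₀ j)))
        (unlessZero-term (sign (toℕ j)) (M zero j) (det (minor₀ j)))
  where
  minor₀ : Fin (suc n) → Matrix n
  minor₀ j r c = M (suc r) (punchIn j c)
  unlessZero-term : ∀ s v d → unlessZero v (s * v * d) ≡ s * v * d
  unlessZero-term s +0       d = sym (trans (cong (_* d) (ℤ.*-zeroʳ s)) (ℤ.*-zeroˡ d))
  unlessZero-term s +[1+ _ ] d = refl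
  unlessZero-term s -[1+ _ ] d = refl

charPolyAt-by-evaluation : ∀ {n} (A : Matrix n) t {v} →
  sparseDet (λ i j → t * identity i j - A i j) ≡ v → charPolyAt A t ≡ v
charPolyAt-by-evaluation A t = trans (sym (sparseDet≡det (λ i j → t * identity i j - A i j)))

reflections : (n : ℕ) → List ℕ → Fin 2 × Fin n → Bool
reflections n as (zero  , _) = false
reflections n as (suc _ , a) = any≡ᵇ as
  where
  any≡ᵇ : List ℕ → Bool
  any≡ᵇ []       = false
  any≡ᵇ (b ∷ bs) = (toℕ a ≡ᵇ b) ∨ any≡ᵇ bs

reflections-inverse : ∀ n .{{_ : ℕ.NonZero n}} as g → reflections n as (dinv n g) ≡ reflections n as g
reflections-inverse n as (zero  , _) = refl
reflections-inverse n as (suc _ , _) = refl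

S₈ : Fin 2 × Fin 4 → Bool
S₈ = reflections 4 (0 ∷ 1 ∷ [])


p₈[1] : charPolyAt (cayleyAdj (Dihedral 4) S₈) (+ 1) ≡ - + 3
p₈[1] = charPolyAt-by-evaluation (cayleyAdj (Dihedral 4) S₈) (+ 1) refl

p₈[-1] : charPolyAt (cayleyAdj (Dihedral 4) S₈) (- + 1) ≡ - + 3
p₈[-1] = charPolyAt-by-evaluation (cayleyAdj (Dihedral 4) S₈) (- + 1) refl

p₈[3] : charPolyAt (cayleyAdj (Dihedral 4) S₈) (+ 3) ≡ + 2205
p₈[3] = charPolyAt-by-evaluation (cayleyAdj (Dihedral 4) S₈) (+ 3) refl

R₈ : List ℤ
R₈ = - + 2 ∷ + 0 ∷ + 2 ∷ []

module _ {λs : Fin 8 → ℤ} (split : Splits (charPolyAt (cayleyAdj (Dihedral 4) S₈)) λs) where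
  private
    in-R₈ : ∀ i → λs i ∈ R₈
    in-R₈ i = eigenvalue-search split (+ 1) p₈[1] (λ ()) (λ x → (- + 1 - x) ∣ - + 3 → x ∈ R₈)
      (toWitness {a? = all? (λ d → (d ∣? - + 3) →-dec (((- + 1 - (+ 1 - d)) ∣? - + 3) →-dec ((+ 1 - d) ∈? R₈))) (window 3)} _) i
      (subst ((- + 1 - λs i) ∣_) p₈[-1] (eigenvalue-∣ split (- + 1) i))

    counted₈ : sum (map (multiplicity λs) R₈) ℕ.≤ 7
    counted₈ =
      ℕ.+-mono-≤ (multiplicity≤-at split (+ 1) (- + 2) 1 p₈[1] (toWitnessFalse {a? = (+ 3) ^ 2 ∣? - + 3} _))
     (ℕ.+-mono-≤ (multiplicity≤-at split (+ 3) (+ 0) 2 p₈[3] (toWitnessFalse {a? = (+ 3) ^ 3 ∣? + 2205} _))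
     (ℕ.+-mono-≤ (multiplicity≤-at split (- + 1) (+ 2) 1 p₈[-1] (toWitnessFalse {a? = (- + 3) ^ 2 ∣? - + 3} _))
      z≤n))

  D₈-splitting-impossible : ⊥
  D₈-splitting-impossible = ℕ.<-irrefl refl (ℕ.≤-trans (pigeonhole λs R₈ in-R₈) counted₈)

D₈-not-integral : ¬ CayleyIntegral (Dihedral 4)
D₈-not-integral integral = D₈-splitting-impossible
  {λs = proj₁ (integral S₈ refl (reflections-inverse 4 (0 ∷ 1 ∷ [])))}
  (splits {p = charPolyAt (cayleyAdj (Dihedral 4) S₈)} (proj₂ (integral S₈ refl (reflections-inverse 4 (0 ∷ 1 ∷ [])))))

S₁₂ : Fin 2 × Fin 6 → Bool
S₁₂ = reflections 6 (0 ∷ 1 ∷ 3 ∷ [])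

p₁₂[0] : charPolyAt (cayleyAdj (Dihedral 6) S₁₂) (+ 0) ≡ + 81
p₁₂[0] = charPolyAt-by-evaluation (cayleyAdj (Dihedral 6) S₁₂) (+ 0) refl

p₁₂[2] : charPolyAt (cayleyAdj (Dihedral 6) S₁₂) (+ 2) ≡ - + 135
p₁₂[2] = charPolyAt-by-evaluation (cayleyAdj (Dihedral 6) S₁₂) (+ 2) refl

p₁₂[-2] : charPolyAt (cayleyAdj (Dihedral 6) S₁₂) (- + 2) ≡ - + 135
p₁₂[-2] = charPolyAt-by-evaluation (cayleyAdj (Dihedral 6) S₁₂) (- + 2) refl

R₁₂ : List ℤ
R₁₂ = + 1 ∷ - + 1 ∷ + 3 ∷ - + 3 ∷ []

module _ {λs : Fin 12 → ℤ} (split : Splits (charPolyAt (cayleyAdj (Dihedral 6) S₁₂)) λs) where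
  private
    in-R₁₂ : ∀ i → λs i ∈ R₁₂
    in-R₁₂ i = eigenvalue-search split (+ 0) p₁₂[0] (λ ())
      (λ x → (+ 2 - x) ∣ - + 135 → (- + 2 - x) ∣ - + 135 → x ∈ R₁₂)
      (toWitness {a? = all? (λ d → (d ∣? + 81) →-dec (((+ 2 - (+ 0 - d)) ∣? - + 135)
                                     →-dec (((- + 2 - (+ 0 - d)) ∣? - + 135) →-dec ((+ 0 - d) ∈? R₁₂)))) (window 81)} _) i
      (subst ((+ 2 - λs i) ∣_) p₁₂[2] (eigenvalue-∣ split (+ 2) i))
      (subst ((- + 2 - λs i) ∣_) p₁₂[-2] (eigenvalue-∣ split (- + 2) i))

    counted₁₂ : sum (map (multiplicity λs) R₁₂) ℕ.≤ 11
    counted₁₂ =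
      ℕ.+-mono-≤ (multiplicity≤-at split (- + 2) (+ 1) 3 p₁₂[-2] (toWitnessFalse {a? = (- + 3) ^ 4 ∣? - + 135} _))
     (ℕ.+-mono-≤ (multiplicity≤-at split (+ 2) (- + 1) 3 p₁₂[2] (toWitnessFalse {a? = (+ 3) ^ 4 ∣? - + 135} _))
     (ℕ.+-mono-≤ (multiplicity≤-at split (- + 2) (+ 3) 1 p₁₂[-2] (toWitnessFalse {a? = (- + 5) ^ 2 ∣? - + 135} _))
     (ℕ.+-mono-≤ (multiplicity≤-at split (+ 2) (- + 3) 1 p₁₂[2] (toWitnessFalse {a? = (+ 5) ^ 2 ∣? - + 135} _))
      z≤n)))

  D₁₂-splitting-impossible : ⊥
  D₁₂-splitting-impossible = ℕ.<-irrefl refl (ℕ.≤-trans (pigeonhole λs R₁₂ in-R₁₂) counted₁₂)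

D₁₂-not-integral : ¬ CayleyIntegral (Dihedral 6)
D₁₂-not-integral integral = D₁₂-splitting-impossible
  {λs = proj₁ (integral S₁₂ refl (reflections-inverse 6 (0 ∷ 1 ∷ 3 ∷ [])))}
  (splits {p = charPolyAt (cayleyAdj (Dihedral 6) S₁₂)} (proj₂ (integral S₁₂ refl (reflections-inverse 6 (0 ∷ 1 ∷ 3 ∷ [])))))

not-integral-cong : ∀ m n → m ≡ n → .{{_ : NonZero m}} .{{_ : NonZero n}} →
  ¬ CayleyIntegral (Dihedral m) → ¬ CayleyIntegral (Dihedral n)
not-integral-cong m .m refl not-integral = not-integral

lemma2p6 : (n : ℕ) .{{_ : NonZero n}} → 4 ≤ n → ¬ CayleyIntegral (Dihedral n)
lemma2p6 0 ()
lemma2p6 1 (s≤s ())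
lemma2p6 2 (s≤s (s≤s ()))
lemma2p6 3 (s≤s (s≤s (s≤s ())))
lemma2p6 n@4 ⦃ i ⦄ _ = not-integral-cong 4 n refl ⦃ record { nonZero = _ } ⦄ ⦃ i ⦄ D₈-not-integral
lemma2p6 n@5 ⦃ i ⦄ _ = not-integral-cong (3 Data.Nat.+ 2) n refl ⦃ record { nonZero = _ } ⦄ ⦃ i ⦄
  (rotation±1-not-integral 2 (s≤s (s≤s z≤n)) (λ ()))
lemma2p6 n@6 ⦃ i ⦄ _ = not-integral-cong 6 n refl ⦃ record { nonZero = _ } ⦄ ⦃ i ⦄ D₁₂-not-integral
lemma2p6 n@(suc (suc (suc (suc (suc (suc (suc m))))))) ⦃ i ⦄ _ =
  not-integral-cong (3 Data.Nat.+ (4 Data.Nat.+ m)) n refl ⦃ record { nonZero = _ } ⦄ ⦃ i ⦄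
    (rotation±1-not-integral (4 Data.Nat.+ m) (s≤s (s≤s z≤n)) (λ ()))
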